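{- For all sufficiently large $n$ we have \[\operatorname{inv}(n)\geq n-\sqrt{2n\log(n)}.\] Moreover, the probability that a uniformly random labelled $n$-vertex tournament has inversion number at least $n-\sqrt{2n\log(n)}$ tends to $1$ as $n\to\infty$.
   Context: For a digraph $D$ and $X\subseteq V(D)$, inverting $X$ in $D$ means reversing the direction of every edge with both endpoints in $X$. A family $X_1,\dots,X_k\subseteq V(D)$ is a decycling family of $D$ if inverting $X_1,\dots,X_k$ in turn yields an acyclic digraph; $\operatorname{inv}(D)$ is the minimum size of a decycling family. For $n\in\mathbb{N}$, $\operatorname{inv}(n)$ denotes the maximum inversion number of an oriented graph (equivalently, a tournament) on $n$ vertices. Logarithms are base $2$. -}

module Defs where

open import Data.Nat using (ℕ; zero; suc; _+_; _*_; _∸_; _^_; _≤_)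
open import Data.Fin using (Fin)
open import Data.Bool using (Bool; true; false; if_then_else_; _∧_)
open import Data.Vec using (Vec; []; _∷_)
open import Data.List using (List; length)
open import Data.List.Relation.Unary.All using (All)
open import Data.List.Relation.Unary.AllPairs using (AllPairs)
open import Data.Product using (Σ; ∃; _×_; _,_; proj₁)
open import Data.Nat.Combinatorics using (_C_)
open import Relation.Binary.PropositionalEquality using (_≡_; _≢_)
open import Relation.Nullary using (¬_)

Digraph : ℕ → Set
Digraph n = Fin n → Fin n → Bool

VSubset : ℕ → Set
VSubset n = Fin n → Bool

invert : ∀ {n} → Digraph n → VSubset n → Digraph n
invert D X i j = if X i ∧ X j then D j i else D i j

invertAll : ∀ {n k} → Digraph n → Vec (VSubset n) k → Digraph n
invertAll D []       = D
invertAll D (X ∷ Xs) = invertAll (invert D X) Xs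

data Walk {n : ℕ} (D : Digraph n) : Fin n → Fin n → Set where
  arc  : ∀ {i j}   → D i j ≡ true → Walk D i j
  step : ∀ {i j k} → D i j ≡ true → Walk D j k → Walk D i k

Acyclic : ∀ {n} → Digraph n → Set
Acyclic D = ∀ i → ¬ Walk D i i

IsDecyclingFamily : ∀ {n k} → Digraph n → Vec (VSubset n) k → Set
IsDecyclingFamily D Xs = Acyclic (invertAll D Xs)

-- "inv(D) ≥ t" for an upward-closed set of integer thresholds given by a
-- predicate P: the minimum size of a decycling family satisfies P, i.e.
-- every size k admitting a decycling family satisfies P.
InvSatisfies : ∀ {n} → Digraph n → (ℕ → Set) → Set
InvSatisfies D P = ∀ k (Xs : Vec (VSubset _ ) k) → IsDecyclingFamily D Xs → P k

IsTournament : ∀ {n} → Digraph n → Set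
IsTournament D = (∀ i → D i i ≡ false) × (∀ i j → i ≢ j → D i j ≢ D j i)

Tournament : ℕ → Set
Tournament n = Σ (Digraph n) IsTournament

Differ : ∀ {n} → Tournament n → Tournament n → Set
Differ {n} (D , _) (E , _) = Σ (Fin n) λ i → Σ (Fin n) λ j → D i j ≢ E i j

-- Integer k satisfies k ≥ n − √(2 n log₂ n).  For n ≥ 1 this is
-- equivalent to (n ∸ k)² ≤ 2 n log₂ n, i.e. 2^((n∸k)²) ≤ n^(2n).
AboveBound : ℕ → ℕ → Set
AboveBound n k = 2 ^ ((n ∸ k) * (n ∸ k)) ≤ n ^ (2 * n)

numTournaments : ℕ → ℕ
numTournaments n = 2 ^ (n C 2)

{-# OPTIONS --safe #-}
-- Inverting a decycling family X₁, …, X_k of a tournament T yields a transitive tournament A,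
-- and T is recovered from A by reversing the arc between i and j exactly when i and j lie together
-- in an odd number of the Xₗ, i.e. when vᵢ · vⱼ = 1 for the membership vectors vᵢ ∈ 𝔽₂ᵏ. So a
-- tournament with inv ≤ K is determined by a vertex order (n! choices) and the Gram matrix of n
-- vectors spanning a space of dimension r ≤ K, which has at most n ^ (n - r) · 2 ^ (r (n - r) +
-- r (r + 1) / 2) codes. For K = n - t with t the least integer such that t² > 2 n log n, these
-- number at most 2 ^ (n choose 2) / m for large n, and all other tournaments have inv ≥ n - √(2 n log n).

module Submission where

open import Defs
open import Data.Nat using (ℕ; _*_; _∸_; _≤_)
open import Data.Product using (Σ; _×_; proj₁)
open import Data.List using (List; length)
open import Data.List.Relation.Unary.All using (All)
open import Data.List.Relation.Unary.AllPairs using (AllPairs)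

open import Data.Nat
  using (zero; suc; _+_; _^_; _<_; _!; _⊓_; _<ᵇ_; z≤n; s≤s; NonZero; >-nonZero; _≤′_; ≤′-refl; ≤′-step)
open import Data.Nat.Properties
open import Data.Nat.Combinatorics using (_C_; nC1≡n; nCk+nC[k+1]≡[n+1]C[k+1])
open import Data.Nat.Solver using (module +-*-Solver)
open import Data.Bool using (Bool; true; false; not; _∧_; _xor_; if_then_else_)
import Data.Bool.Properties as Bool
open import Data.Fin using (Fin; zero; suc; toℕ; fromℕ<; punchIn)
import Data.Fin.Properties as Fin
open import Data.Fin.Properties using (toℕ-fromℕ<; toℕ-injective; punchIn-injective; punchInᵢ≢i; toℕ<n)
open import Data.Vec as Vec using (Vec; []; _∷_; zipWith; replicate)
open import Data.Vec.Properties
  using (≡-dec; ∷-injective; lookup-map; lookup∘tabulate; map-cong; map-∘; zipWith-assoc; zipWith-comm;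
         zipWith-identityˡ; zipWith-identityʳ)
open import Data.List as List using ([]; _∷_; _++_; cartesianProductWith; filter; allFin)
open import Data.List.Properties using (length-++; length-map; length-tabulate)
open import Data.List.Relation.Unary.All using ([]; _∷_)
import Data.List.Relation.Unary.All as All
import Data.List.Relation.Unary.All.Properties as All
open import Data.List.Relation.Unary.Any using (Any; here; there; any?; satisfied)
open import Data.List.Relation.Unary.AllPairs using ([]; _∷_)
import Data.List.Relation.Unary.AllPairs as AllPairs
import Data.List.Relation.Unary.AllPairs.Properties as AllPairs
open import Data.List.Relation.Unary.Unique.Propositional using (Unique)
import Data.List.Relation.Unary.Unique.Propositional.Properties as Unique
open import Data.List.Membership.Propositional using (_∈_; lose)
open import Data.List.Membership.Propositional.Properties
  using (∈-cartesianProductWith⁺; ∈-++⁺ˡ; ∈-++⁺ʳ; ∈-map⁺; ∈-allFin)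
open import Data.Product using (_,_; proj₂)
open import Data.Sum using (inj₁; inj₂)
open import Data.Empty using (⊥; ⊥-elim)
open import Function using (_∘_)
open import Relation.Binary.PropositionalEquality
open import Relation.Binary.Definitions using (tri<; tri≈; tri>)
open import Relation.Nullary using (¬_; Dec; yes; no)
open import Relation.Nullary.Decidable using (¬?; dec-true; dec-false)
open import Relation.Unary using (Decidable)
open import Algebra.Bundles using (CommutativeRing; CommutativeMonoid)
open import Algebra.Properties.CommutativeSemigroup
  (CommutativeMonoid.commutativeSemigroup (CommutativeRing.+-commutativeMonoid Bool.xor-∧-commutativeRing))
  using () renaming (interchange to xor-interchange)
open +-*-Solver

module _ {A B : Set} (R : A → B → Set) where

  private
    remove : ∀ {P : B → Set} {ys} → Any P ys → List B
    remove {ys = _ ∷ ys} (here _)  = ys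
    remove {ys = y ∷ _}  (there p) = y ∷ remove p

    length-remove : ∀ {P : B → Set} {ys} (p : Any P ys) → length ys ≡ suc (length (remove p))
    length-remove (here _)  = refl
    length-remove (there p) = cong suc (length-remove p)

    any-remove : ∀ {P Q : B → Set} {ys} (p : Any P ys) → Any Q ys →
                 (∀ {y} → P y → Q y → ⊥) → Any Q (remove p)
    any-remove (here py) (here qy) disjoint = ⊥-elim (disjoint py qy)
    any-remove (here _)  (there q) _        = q
    any-remove (there _) (here qy) _        = here qy
    any-remove (there p) (there q) disjoint = there (any-remove p q disjoint)

  pigeonhole : ∀ {xs ys} → AllPairs (λ x x′ → ∀ {y} → R x y → R x′ y → ⊥) xs →
               All (λ x → Any (R x) ys) xs → length xs ≤ length ys
  pigeonhole []                    []                 = z≤n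
  pigeonhole {x ∷ _} (x-disjoint ∷ disjoint) (x-hit ∷ hits) =
    subst (_ ≤_) (sym (length-remove x-hit))
      (s≤s (pigeonhole disjoint (All.zipWith transfer (x-disjoint , hits))))
    where
    transfer : ∀ {x′} → (∀ {y} → R x y → R x′ y → ⊥) × Any (R x′) _ → Any (R x′) (remove x-hit)
    transfer (d , h) = any-remove x-hit h d

length-cartesianProductWith : ∀ {A B C : Set} (f : A → B → C) xs ys →
  length (cartesianProductWith f xs ys) ≡ length xs * length ys
length-cartesianProductWith f []       ys = refl
length-cartesianProductWith f (x ∷ xs) ys = begin
  length (List.map (f x) ys ++ cartesianProductWith f xs ys)
    ≡⟨ length-++ (List.map (f x) ys) ⟩
  length (List.map (f x) ys) + length (cartesianProductWith f xs ys)
    ≡⟨ cong₂ _+_ (length-map (f x) ys) (length-cartesianProductWith f xs ys) ⟩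
  length ys + length xs * length ys ∎
  where open ≡-Reasoning

allBools : List Bool
allBools = true ∷ false ∷ []

allVecs : ∀ n → List (Vec Bool n)
allVecs zero    = [] ∷ []
allVecs (suc n) = cartesianProductWith _∷_ allBools (allVecs n)

length-allVecs : ∀ n → length (allVecs n) ≡ 2 ^ n
length-allVecs zero    = refl
length-allVecs (suc n) = trans (length-cartesianProductWith _∷_ allBools (allVecs n))
                               (cong (2 *_) (length-allVecs n))

∈-allVecs : ∀ {n} (v : Vec Bool n) → v ∈ allVecs n
∈-allVecs []      = here refl
∈-allVecs (b ∷ v) = ∈-cartesianProductWith⁺ _∷_ (∈-allBools b) (∈-allVecs v)
  where
  ∈-allBools : ∀ b → b ∈ allBools
  ∈-allBools true  = here refl
  ∈-allBools false = there (here refl)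

allVecs-unique : ∀ n → Unique (allVecs n)
allVecs-unique zero    = [] ∷ []
allVecs-unique (suc n) =
  Unique.cartesianProductWith⁺ _∷_ ∷-injective allBools-unique (allVecs-unique n)
  where
  allBools-unique : Unique allBools
  allBools-unique = ((λ ()) ∷ []) ∷ [] ∷ []

-- The first vector lists the arcs from vertex 0 to the later vertices.
data TournamentCode : ℕ → Set where
  []  : TournamentCode 0
  _∷_ : ∀ {n} → Vec Bool n → TournamentCode n → TournamentCode (suc n)

decode : ∀ {n} → TournamentCode n → Digraph n
decode (v ∷ c) zero    zero    = false
decode (v ∷ c) zero    (suc j) = Vec.lookup v j
decode (v ∷ c) (suc i) zero    = not (Vec.lookup v i)
decode (v ∷ c) (suc i) (suc j) = decode c i j

decode-irreflexive : ∀ {n} (c : TournamentCode n) i → decode c i i ≡ false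
decode-irreflexive (v ∷ c) zero    = refl
decode-irreflexive (v ∷ c) (suc i) = decode-irreflexive c i

decode-antisymmetric : ∀ {n} (c : TournamentCode n) i j → i ≢ j → decode c i j ≢ decode c j i
decode-antisymmetric (v ∷ c) zero    zero    i≢j = ⊥-elim (i≢j refl)
decode-antisymmetric (v ∷ c) zero    (suc j) _   = Bool.not-¬ refl
decode-antisymmetric (v ∷ c) (suc i) zero    _   = Bool.not-¬ refl ∘ sym
decode-antisymmetric (v ∷ c) (suc i) (suc j) i≢j =
  decode-antisymmetric c i j (i≢j ∘ cong suc)

decodeTournament : ∀ {n} → TournamentCode n → Tournament n
decodeTournament c = decode c , decode-irreflexive c , decode-antisymmetric c

allTournamentCodes : ∀ n → List (TournamentCode n)
allTournamentCodes zero    = [] ∷ []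
allTournamentCodes (suc n) = cartesianProductWith _∷_ (allVecs n) (allTournamentCodes n)

suc[n]C2 : ∀ n → suc n C 2 ≡ n + n C 2
suc[n]C2 n = trans (sym (nCk+nC[k+1]≡[n+1]C[k+1] n 1)) (cong (_+ n C 2) (nC1≡n n))

length-allTournamentCodes : ∀ n → length (allTournamentCodes n) ≡ numTournaments n
length-allTournamentCodes zero    = refl
length-allTournamentCodes (suc n) = begin
  length (cartesianProductWith _∷_ (allVecs n) (allTournamentCodes n))
    ≡⟨ length-cartesianProductWith _∷_ (allVecs n) (allTournamentCodes n) ⟩
  length (allVecs n) * length (allTournamentCodes n)
    ≡⟨ cong₂ _*_ (length-allVecs n) (length-allTournamentCodes n) ⟩
  2 ^ n * 2 ^ (n C 2)
    ≡⟨ sym (^-distribˡ-+-* 2 n (n C 2)) ⟩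
  2 ^ (n + n C 2)
    ≡⟨ cong (2 ^_) (sym (suc[n]C2 n)) ⟩
  2 ^ (suc n C 2) ∎
  where open ≡-Reasoning

allTournamentCodes-unique : ∀ n → Unique (allTournamentCodes n)
allTournamentCodes-unique zero    = [] ∷ []
allTournamentCodes-unique (suc n) =
  Unique.cartesianProductWith⁺ _∷_ (λ { refl → refl , refl })
    (allVecs-unique n) (allTournamentCodes-unique n)

lookup-≢ : ∀ {n} (v w : Vec Bool n) → v ≢ w → Σ (Fin n) λ l → Vec.lookup v l ≢ Vec.lookup w l
lookup-≢ []      []      v≢w = ⊥-elim (v≢w refl)
lookup-≢ (a ∷ v) (b ∷ w) v≢w with a Bool.≟ b
... | no a≢b = zero , a≢b
... | yes refl with lookup-≢ v w (v≢w ∘ cong (a ∷_))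
...   | l , d = suc l , d

decode-differ : ∀ {n} (c d : TournamentCode n) → c ≢ d → Differ (decodeTournament c) (decodeTournament d)
decode-differ [] [] c≢d = ⊥-elim (c≢d refl)
decode-differ (v ∷ c) (w ∷ d) c≢d with ≡-dec Bool._≟_ v w
... | no v≢w = let l , diff = lookup-≢ v w v≢w in zero , suc l , diff
... | yes refl = let i , j , diff = decode-differ c d (c≢d ∘ cong (v ∷_)) in suc i , suc j , diff

allTournaments : ∀ n → List (Tournament n)
allTournaments n = List.map decodeTournament (allTournamentCodes n)

length-allTournaments : ∀ n → length (allTournaments n) ≡ numTournaments n
length-allTournaments n =
  trans (length-map decodeTournament (allTournamentCodes n)) (length-allTournamentCodes n)

allTournaments-differ : ∀ n → AllPairs Differ (allTournaments n)
allTournaments-differ n =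
  AllPairs.map⁺ (AllPairs.map (decode-differ _ _) (allTournamentCodes-unique n))

coParity : ∀ {n k} → Vec (VSubset n) k → Fin n → Fin n → Bool
coParity []       i j = false
coParity (X ∷ Xs) i j = (X i ∧ X j) xor coParity Xs i j

coParity-comm : ∀ {n k} (Xs : Vec (VSubset n) k) i j → coParity Xs i j ≡ coParity Xs j i
coParity-comm []       i j = refl
coParity-comm (X ∷ Xs) i j = cong₂ _xor_ (Bool.∧-comm (X i) (X j)) (coParity-comm Xs i j)

invertAll-coParity : ∀ {n k} (D : Digraph n) (Xs : Vec (VSubset n) k) i j →
                     invertAll D Xs i j ≡ (if coParity Xs i j then D j i else D i j)
invertAll-coParity D []       i j = refl
invertAll-coParity D (X ∷ Xs) i j
  rewrite invertAll-coParity (invert D X) Xs i j | Bool.∧-comm (X j) (X i)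
  with X i ∧ X j | coParity Xs i j
... | true  | true  = refl
... | true  | false = refl
... | false | true  = refl
... | false | false = refl

invertAll-tournament : ∀ {n k} {D : Digraph n} (Xs : Vec (VSubset n) k) →
                       IsTournament D → IsTournament (invertAll D Xs)
invertAll-tournament {D = D} Xs (irreflexive , antisymmetric) =
  irreflexive′ , antisymmetric′
  where
  irreflexive′ : ∀ i → invertAll D Xs i i ≡ false
  irreflexive′ i rewrite invertAll-coParity D Xs i i with coParity Xs i i
  ... | true  = irreflexive i
  ... | false = irreflexive i

  antisymmetric′ : ∀ i j → i ≢ j → invertAll D Xs i j ≢ invertAll D Xs j i
  antisymmetric′ i j i≢j
    rewrite invertAll-coParity D Xs i j | invertAll-coParity D Xs j i | coParity-comm Xs j i
    with coParity Xs i j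
  ... | true  = antisymmetric j i (i≢j ∘ sym)
  ... | false = antisymmetric i j i≢j

TransitiveDigraph : ∀ {n} → Digraph n → Set
TransitiveDigraph A = ∀ {i j k} → A i j ≡ true → A j k ≡ true → A i k ≡ true

-- A missing arc i → k is either the reverse arc, closing a cycle, or a loop, which is a cycle.
acyclic-tournament-transitive : ∀ {n} {A : Digraph n} →
                                IsTournament A → Acyclic A → TransitiveDigraph A
acyclic-tournament-transitive {A = A} (_ , antisymmetric) acyclic {i} {j} {k} aij ajk
  with A i k in aik
... | true  = refl
... | false with A k i in aki
...   | true  = ⊥-elim (acyclic i (step aij (step ajk (arc aki))))
...   | false with i Data.Fin.≟ k
...     | yes refl = ⊥-elim (acyclic i (step aij (arc ajk)))
...     | no  i≢k  = ⊥-elim (antisymmetric i k i≢k (trans aik (sym aki)))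

<ᵇ-true : ∀ {m n} → m < n → (m <ᵇ n) ≡ true
<ᵇ-true {m} {n} = dec-true (m <? n)

<ᵇ-false : ∀ {m n} → ¬ m < n → (m <ᵇ n) ≡ false
<ᵇ-false {m} {n} = dec-false (m <? n)

-- Vertex 0 gets rank p; the ranks of the remaining vertices are punched in around p.
data RankCode : ℕ → Set where
  []  : RankCode 0
  _∷_ : ∀ {n} → Fin (suc n) → RankCode n → RankCode (suc n)

rank : ∀ {n} → RankCode n → Fin n → Fin n
rank (p ∷ c) zero    = p
rank (p ∷ c) (suc j) = punchIn p (rank c j)

rankOrder : ∀ {n} → RankCode n → Digraph n
rankOrder c i j = toℕ (rank c i) <ᵇ toℕ (rank c j)

rank-injective : ∀ {n} (c : RankCode n) {i j} → rank c i ≡ rank c j → i ≡ j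
rank-injective (p ∷ c) {zero}  {zero}  _  = refl
rank-injective (p ∷ c) {zero}  {suc j} eq = ⊥-elim (punchInᵢ≢i p (rank c j) (sym eq))
rank-injective (p ∷ c) {suc i} {zero}  eq = ⊥-elim (punchInᵢ≢i p (rank c i) eq)
rank-injective (p ∷ c) {suc i} {suc j} eq =
  cong suc (rank-injective c (punchIn-injective p (rank c i) (rank c j) eq))

punchIn-<ᵇ-pivot : ∀ {n} (p : Fin (suc n)) x → (toℕ (punchIn p x) <ᵇ toℕ p) ≡ (toℕ x <ᵇ toℕ p)
punchIn-<ᵇ-pivot zero    x       = refl
punchIn-<ᵇ-pivot (suc p) zero    = refl
punchIn-<ᵇ-pivot (suc p) (suc x) = punchIn-<ᵇ-pivot p x

pivot-<ᵇ-punchIn : ∀ {n} (p : Fin (suc n)) x → (toℕ p <ᵇ toℕ (punchIn p x)) ≡ not (toℕ x <ᵇ toℕ p)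
pivot-<ᵇ-punchIn zero    x       = refl
pivot-<ᵇ-punchIn (suc p) zero    = refl
pivot-<ᵇ-punchIn (suc p) (suc x) = pivot-<ᵇ-punchIn p x

punchIn-<ᵇ-punchIn : ∀ {n} (p : Fin (suc n)) x y →
                     (toℕ (punchIn p x) <ᵇ toℕ (punchIn p y)) ≡ (toℕ x <ᵇ toℕ y)
punchIn-<ᵇ-punchIn zero    x       y       = refl
punchIn-<ᵇ-punchIn (suc p) zero    zero    = refl
punchIn-<ᵇ-punchIn (suc p) zero    (suc y) = refl
punchIn-<ᵇ-punchIn (suc p) (suc x) zero    = refl
punchIn-<ᵇ-punchIn (suc p) (suc x) (suc y) = punchIn-<ᵇ-punchIn p x y

minimumOr : ∀ {m} → (Fin m → ℕ) → ℕ → ℕ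
minimumOr {zero}  f d = d
minimumOr {suc m} f d = f zero ⊓ minimumOr (f ∘ suc) d

minimumOr-≤-default : ∀ {m} (f : Fin m → ℕ) d → minimumOr f d ≤ d
minimumOr-≤-default {zero}  f d = ≤-refl
minimumOr-≤-default {suc m} f d = ≤-trans (m⊓n≤n (f zero) _) (minimumOr-≤-default (f ∘ suc) d)

minimumOr-≤ : ∀ {m} (f : Fin m → ℕ) d j → minimumOr f d ≤ f j
minimumOr-≤ f d zero    = m⊓n≤m (f zero) _
minimumOr-≤ f d (suc j) = ≤-trans (m⊓n≤n (f zero) _) (minimumOr-≤ (f ∘ suc) d j)

<-minimumOr : ∀ {m} (f : Fin m → ℕ) {d x} → (∀ j → x < f j) → x < d → x < minimumOr f d
<-minimumOr {zero}  f _     x<d = x<d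
<-minimumOr {suc m} f x<f x<d   = ⊓-glb (x<f zero) (<-minimumOr (f ∘ suc) (x<f ∘ suc) x<d)

-- Vertex 0 is placed just below the lowest-ranked vertex it beats.
insertionPoint : ∀ {n} {A : Digraph (suc n)} → TransitiveDigraph A → (c : RankCode n) →
                 (∀ i j → A (suc i) (suc j) ≡ rankOrder c i j) →
                 Σ (Fin (suc n)) λ p → ∀ j → A (suc j) zero ≡ (toℕ (rank c j) <ᵇ toℕ p)
insertionPoint {n} {A} transitive c rest≡rankOrder = p , beats≡below
  where
  r : Fin n → ℕ
  r j = toℕ (rank c j)

  lossRank : Fin n → ℕ
  lossRank j = if A (suc j) zero then n else r j

  p : Fin (suc n)
  p = fromℕ< (s≤s (minimumOr-≤-default lossRank n))

  toℕ-p : toℕ p ≡ minimumOr lossRank n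
  toℕ-p = toℕ-fromℕ< (s≤s (minimumOr-≤-default lossRank n))

  beats⇒below : ∀ j → A (suc j) zero ≡ true → r j < toℕ p
  beats⇒below j j→0 = subst (r j <_) (sym toℕ-p) (<-minimumOr lossRank below-losses (toℕ<n (rank c j)))
    where
    below-losses : ∀ j′ → r j < lossRank j′
    below-losses j′ with A (suc j′) zero in j′→0
    ... | true  = toℕ<n (rank c j)
    ... | false with <-cmp (r j) (r j′)
    ...   | tri< j<j′ _ _ = j<j′
    ...   | tri≈ _ j≡j′ _ with rank-injective c (toℕ-injective j≡j′)
    ...     | refl = ⊥-elim (Bool.not-¬ refl (trans (sym j→0) j′→0))
    below-losses j′ | false | tri> _ _ j′<j =
      ⊥-elim (Bool.not-¬ refl (trans (sym (transitive j′→j j→0)) j′→0))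
      where
      j′→j : A (suc j′) (suc j) ≡ true
      j′→j = trans (rest≡rankOrder j′ j) (<ᵇ-true j′<j)

  loses⇒above : ∀ j → A (suc j) zero ≡ false → toℕ p ≤ r j
  loses⇒above j j↛0 = subst₂ _≤_ (sym toℕ-p) (cong (if_then n else r j) j↛0) (minimumOr-≤ lossRank n j)

  beats≡below : ∀ j → A (suc j) zero ≡ (r j <ᵇ toℕ p)
  beats≡below j with A (suc j) zero in j→0
  ... | true  = sym (<ᵇ-true (beats⇒below j j→0))
  ... | false = sym (<ᵇ-false (≤⇒≯ (loses⇒above j j→0)))

transitiveTournament⇒rankOrder : ∀ {n} {A : Digraph n} → IsTournament A → TransitiveDigraph A →
                                 Σ (RankCode n) λ c → ∀ i j → A i j ≡ rankOrder c i j
transitiveTournament⇒rankOrder {zero} _ _ = [] , λ ()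
transitiveTournament⇒rankOrder {suc n} {A} (irreflexive , antisymmetric) transitive
  with transitiveTournament⇒rankOrder {A = λ i j → A (suc i) (suc j)}
         (irreflexive ∘ suc , λ i j i≢j → antisymmetric (suc i) (suc j) (i≢j ∘ Fin.suc-injective))
         transitive
... | c , rest≡rankOrder with insertionPoint {A = A} transitive c rest≡rankOrder
... | p , beats≡below = p ∷ c , A≡rankOrder
  where
  A≡rankOrder : ∀ i j → A i j ≡ rankOrder (p ∷ c) i j
  A≡rankOrder zero    zero    = trans (irreflexive zero) (sym (<ᵇ-false (n≮n (toℕ p))))
  A≡rankOrder zero    (suc j) = begin
    A zero (suc j)                           ≡⟨ Bool.¬-not (antisymmetric zero (suc j) (λ ())) ⟩
    not (A (suc j) zero)                     ≡⟨ cong not (beats≡below j) ⟩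
    not (toℕ (rank c j) <ᵇ toℕ p)            ≡⟨ sym (pivot-<ᵇ-punchIn p (rank c j)) ⟩
    rankOrder (p ∷ c) zero (suc j)           ∎
    where open ≡-Reasoning
  A≡rankOrder (suc i) zero    =
    trans (beats≡below i) (sym (punchIn-<ᵇ-pivot p (rank c i)))
  A≡rankOrder (suc i) (suc j) =
    trans (rest≡rankOrder i j) (sym (punchIn-<ᵇ-punchIn p (rank c i) (rank c j)))

allRankCodes : ∀ n → List (RankCode n)
allRankCodes zero    = [] ∷ []
allRankCodes (suc n) = cartesianProductWith _∷_ (allFin (suc n)) (allRankCodes n)

length-allRankCodes : ∀ n → length (allRankCodes n) ≡ n !
length-allRankCodes zero    = refl
length-allRankCodes (suc n) =
  trans (length-cartesianProductWith _∷_ (allFin (suc n)) (allRankCodes n))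
        (cong₂ _*_ (length-tabulate {n = suc n} (λ x → x)) (length-allRankCodes n))

∈-allRankCodes : ∀ {n} (c : RankCode n) → c ∈ allRankCodes n
∈-allRankCodes []      = here refl
∈-allRankCodes (p ∷ c) = ∈-cartesianProductWith⁺ _∷_ (∈-allFin p) (∈-allRankCodes c)

2^-cancel-≤ : ∀ {m n} → 2 ^ m ≤ 2 ^ n → m ≤ n
2^-cancel-≤ 2^m≤2^n = ≮⇒≥ (λ n<m → <⇒≱ (^-monoʳ-< 2 (s≤s (s≤s z≤n)) n<m) 2^m≤2^n)

infixl 6 _⊕_
infix  7 _·_

_⊕_ : ∀ {k} → Vec Bool k → Vec Bool k → Vec Bool k
_⊕_ = zipWith _xor_

0ᵥ : ∀ {k} → Vec Bool k
0ᵥ = replicate _ false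

_·_ : ∀ {k} → Vec Bool k → Vec Bool k → Bool
[]       · []       = false
(a ∷ as) · (b ∷ bs) = (a ∧ b) xor (as · bs)

linComb : ∀ {r k} → Vec Bool r → Vec (Vec Bool k) r → Vec Bool k
linComb []       []       = 0ᵥ
linComb (a ∷ as) (b ∷ bs) = if a then b ⊕ linComb as bs else linComb as bs

⊕-assoc : ∀ {k} (x y z : Vec Bool k) → (x ⊕ y) ⊕ z ≡ x ⊕ (y ⊕ z)
⊕-assoc = zipWith-assoc Bool.xor-assoc

⊕-comm : ∀ {k} (x y : Vec Bool k) → x ⊕ y ≡ y ⊕ x
⊕-comm = zipWith-comm Bool.xor-comm

⊕-identityˡ : ∀ {k} (x : Vec Bool k) → 0ᵥ ⊕ x ≡ x
⊕-identityˡ = zipWith-identityˡ Bool.xor-identityˡ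

⊕-identityʳ : ∀ {k} (x : Vec Bool k) → x ⊕ 0ᵥ ≡ x
⊕-identityʳ = zipWith-identityʳ Bool.xor-identityʳ

⊕-self : ∀ {k} (x : Vec Bool k) → x ⊕ x ≡ 0ᵥ
⊕-self []      = refl
⊕-self (a ∷ x) = cong₂ _∷_ (Bool.xor-same a) (⊕-self x)

⊕-interchange : ∀ {k} (x y z w : Vec Bool k) → (x ⊕ y) ⊕ (z ⊕ w) ≡ (x ⊕ z) ⊕ (y ⊕ w)
⊕-interchange []      []      []      []      = refl
⊕-interchange (a ∷ x) (b ∷ y) (c ∷ z) (d ∷ w) =
  cong₂ _∷_ (xor-interchange a b c d) (⊕-interchange x y z w)

⊕-cancelˡ : ∀ {k} (x : Vec Bool k) {y z} → x ⊕ y ≡ x ⊕ z → y ≡ z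
⊕-cancelˡ x {y} {z} eq = begin
  y             ≡⟨ sym (⊕-identityˡ y) ⟩
  0ᵥ ⊕ y        ≡⟨ cong (_⊕ y) (sym (⊕-self x)) ⟩
  (x ⊕ x) ⊕ y   ≡⟨ ⊕-assoc x x y ⟩
  x ⊕ (x ⊕ y)   ≡⟨ cong (x ⊕_) eq ⟩
  x ⊕ (x ⊕ z)   ≡⟨ sym (⊕-assoc x x z) ⟩
  (x ⊕ x) ⊕ z   ≡⟨ cong (_⊕ z) (⊕-self x) ⟩
  0ᵥ ⊕ z        ≡⟨ ⊕-identityˡ z ⟩
  z             ∎
  where open ≡-Reasoning

⊕-moveʳ : ∀ {k} {x y z : Vec Bool k} → x ⊕ y ≡ z → x ≡ z ⊕ y
⊕-moveʳ {x = x} {y} {z} eq = begin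
  x             ≡⟨ sym (⊕-identityʳ x) ⟩
  x ⊕ 0ᵥ        ≡⟨ cong (x ⊕_) (sym (⊕-self y)) ⟩
  x ⊕ (y ⊕ y)   ≡⟨ sym (⊕-assoc x y y) ⟩
  (x ⊕ y) ⊕ y   ≡⟨ cong (_⊕ y) eq ⟩
  z ⊕ y         ∎
  where open ≡-Reasoning

·-comm : ∀ {k} (x y : Vec Bool k) → x · y ≡ y · x
·-comm []      []      = refl
·-comm (a ∷ x) (b ∷ y) = cong₂ _xor_ (Bool.∧-comm a b) (·-comm x y)

·-zeroˡ : ∀ {k} (y : Vec Bool k) → 0ᵥ · y ≡ false
·-zeroˡ []      = refl
·-zeroˡ (b ∷ y) = ·-zeroˡ y

·-distribʳ-⊕ : ∀ {k} (x y z : Vec Bool k) → (x ⊕ y) · z ≡ (x · z) xor (y · z)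
·-distribʳ-⊕ []      []      []      = refl
·-distribʳ-⊕ (a ∷ x) (b ∷ y) (c ∷ z)
  rewrite ·-distribʳ-⊕ x y z | Bool.∧-distribʳ-xor c a b =
  xor-interchange (a ∧ c) (b ∧ c) (x · z) (y · z)

linComb-zero : ∀ {r k} (B : Vec (Vec Bool k) r) → linComb 0ᵥ B ≡ 0ᵥ
linComb-zero []      = refl
linComb-zero (b ∷ B) = linComb-zero B

linComb-⊕ : ∀ {r k} (a a′ : Vec Bool r) (B : Vec (Vec Bool k) r) →
            linComb (a ⊕ a′) B ≡ linComb a B ⊕ linComb a′ B
linComb-⊕ []          []           []      = sym (⊕-self 0ᵥ)
linComb-⊕ (false ∷ a) (false ∷ a′) (b ∷ B) = linComb-⊕ a a′ B
linComb-⊕ (true ∷ a)  (false ∷ a′) (b ∷ B) rewrite linComb-⊕ a a′ B =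
  sym (⊕-assoc b (linComb a B) (linComb a′ B))
linComb-⊕ (false ∷ a) (true ∷ a′)  (b ∷ B) rewrite linComb-⊕ a a′ B = begin
  b ⊕ (linComb a B ⊕ linComb a′ B)   ≡⟨ sym (⊕-assoc b (linComb a B) (linComb a′ B)) ⟩
  (b ⊕ linComb a B) ⊕ linComb a′ B   ≡⟨ cong (_⊕ linComb a′ B) (⊕-comm b (linComb a B)) ⟩
  (linComb a B ⊕ b) ⊕ linComb a′ B   ≡⟨ ⊕-assoc (linComb a B) b (linComb a′ B) ⟩
  linComb a B ⊕ (b ⊕ linComb a′ B)   ∎
  where open ≡-Reasoning
linComb-⊕ (true ∷ a)  (true ∷ a′)  (b ∷ B) rewrite linComb-⊕ a a′ B = begin
  L ⊕ L′                 ≡⟨ sym (⊕-identityˡ (L ⊕ L′)) ⟩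
  0ᵥ ⊕ (L ⊕ L′)          ≡⟨ cong (_⊕ (L ⊕ L′)) (sym (⊕-self b)) ⟩
  (b ⊕ b) ⊕ (L ⊕ L′)     ≡⟨ ⊕-interchange b b L L′ ⟩
  (b ⊕ L) ⊕ (b ⊕ L′)     ∎
  where open ≡-Reasoning; L = linComb a B; L′ = linComb a′ B

linComb-· : ∀ {r k} (a : Vec Bool r) (B : Vec (Vec Bool k) r) y →
            linComb a B · y ≡ a · Vec.map (_· y) B
linComb-· []          []      y = ·-zeroˡ y
linComb-· (true ∷ a)  (b ∷ B) y
  rewrite ·-distribʳ-⊕ b (linComb a B) y = cong (b · y xor_) (linComb-· a B y)
linComb-· (false ∷ a) (b ∷ B) y = linComb-· a B y

LinearlyIndependent : ∀ {r k} → Vec (Vec Bool k) r → Set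
LinearlyIndependent {r} B = ∀ (a a′ : Vec Bool r) → linComb a B ≡ linComb a′ B → a ≡ a′

-- The 2 ^ r combinations of an independent family are distinct vectors of Bool ^ k.
independent⇒≤ : ∀ {r k} (B : Vec (Vec Bool k) r) → LinearlyIndependent B → r ≤ k
independent⇒≤ {r} {k} B independent = 2^-cancel-≤ (begin
  2 ^ r                          ≡⟨ sym (length-allVecs r) ⟩
  length (allVecs r)             ≡⟨ sym (length-map (λ a → linComb a B) (allVecs r)) ⟩
  length combinations            ≤⟨ pigeonhole _≡_ distinct covered ⟩
  length (allVecs k)             ≡⟨ length-allVecs k ⟩
  2 ^ k                          ∎)
  where
  open ≤-Reasoning
  combinations : List (Vec Bool k)
  combinations = List.map (λ a → linComb a B) (allVecs r)
  distinct : AllPairs (λ x x′ → ∀ {y} → x ≡ y → x′ ≡ y → ⊥) combinations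
  distinct = AllPairs.map⁺ (AllPairs.map (λ a≢a′ {_} e e′ → a≢a′ (independent _ _ (trans e (sym e′))))
                                         (allVecs-unique r))
  covered : All (λ x → Any (x ≡_) (allVecs k)) combinations
  covered = All.map⁺ (All.universal (λ a → ∈-allVecs (linComb a B)) (allVecs r))

gram : ∀ {r k} → Vec (Vec Bool k) r → Vec (Vec Bool r) r
gram B = Vec.map (λ b → Vec.map (b ·_) B) B

bilinearForm : ∀ {r} → Vec (Vec Bool r) r → Vec Bool r → Vec Bool r → Bool
bilinearForm G a a′ = a · Vec.map (_· a′) G

bilinearForm-gram : ∀ {r k} (B : Vec (Vec Bool k) r) a a′ →
                    bilinearForm (gram B) a a′ ≡ linComb a B · linComb a′ B
bilinearForm-gram B a a′ = begin
  a · Vec.map (_· a′) (gram B)                      ≡⟨ cong (a ·_) (sym (map-∘ (_· a′) _ B)) ⟩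
  a · Vec.map (λ b → Vec.map (b ·_) B · a′) B       ≡⟨ cong (a ·_) (map-cong entry B) ⟩
  a · Vec.map (_· linComb a′ B) B                   ≡⟨ sym (linComb-· a B (linComb a′ B)) ⟩
  linComb a B · linComb a′ B                        ∎
  where
  open ≡-Reasoning
  entry : ∀ b → Vec.map (b ·_) B · a′ ≡ b · linComb a′ B
  entry b = begin
    Vec.map (b ·_) B · a′      ≡⟨ ·-comm _ a′ ⟩
    a′ · Vec.map (b ·_) B      ≡⟨ cong (a′ ·_) (map-cong (·-comm b) B) ⟩
    a′ · Vec.map (_· b) B      ≡⟨ sym (linComb-· a′ B b) ⟩
    linComb a′ B · b           ≡⟨ ·-comm _ b ⟩
    b · linComb a′ B           ∎

gram-∷ : ∀ {r k} (x : Vec Bool k) (B : Vec (Vec Bool k) r) →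
         gram (x ∷ B) ≡ (x · x ∷ Vec.map (x ·_) B) ∷ zipWith _∷_ (Vec.map (x ·_) B) (gram B)
gram-∷ x B = cong ((x · x ∷ Vec.map (x ·_) B) ∷_) (column B)
  where
  column : ∀ {s} (C : Vec (Vec Bool _) s) →
           Vec.map (λ b → Vec.map (b ·_) (x ∷ B)) C
             ≡ zipWith _∷_ (Vec.map (x ·_) C) (Vec.map (λ b → Vec.map (b ·_) B) C)
  column []      = refl
  column (c ∷ C) = cong₂ _∷_ (cong (_∷ Vec.map (c ·_) B) (·-comm c x)) (column C)

-- The vectors are read from the last to the first. Each one either lies in the span of the
-- basis chosen so far, and the code stores its coordinates, or it becomes a new basis vector,
-- and the code stores its products with itself and with the earlier basis vectors.
data GramCode : ℕ → ℕ → Set where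
  []       : GramCode 0 0
  inSpan   : ∀ {n r} → Vec Bool r → GramCode n r → GramCode (suc n) r
  newBasis : ∀ {n r} → Vec Bool (suc r) → GramCode n r → GramCode (suc n) (suc r)

basisGram : ∀ {n r} → GramCode n r → Vec (Vec Bool r) r
basisGram []                      = []
basisGram (inSpan _ c)            = basisGram c
basisGram (newBasis (d ∷ row) c)  = (d ∷ row) ∷ zipWith _∷_ row (basisGram c)

coordinates : ∀ {n r} → GramCode n r → Vec (Vec Bool r) n
coordinates []             = []
coordinates (inSpan a c)   = a ∷ coordinates c
coordinates (newBasis _ c) = (true ∷ 0ᵥ) ∷ Vec.map (false ∷_) (coordinates c)

decodeGram : ∀ {n r} → GramCode n r → Fin n → Fin n → Bool
decodeGram c i j = bilinearForm (basisGram c) (Vec.lookup (coordinates c) i) (Vec.lookup (coordinates c) j)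

record GramRepresentation {k n} (vs : Vec (Vec Bool k) n) : Set where
  field
    dimension      : ℕ
    code           : GramCode n dimension
    basis          : Vec (Vec Bool k) dimension
    independent    : LinearlyIndependent basis
    basisGram≡gram : basisGram code ≡ gram basis
    spans          : ∀ i → Vec.lookup vs i ≡ linComb (Vec.lookup (coordinates code) i) basis

independent-∷ : ∀ {r k} {x : Vec Bool k} {B : Vec (Vec Bool k) r} → LinearlyIndependent B →
                (∀ a → linComb a B ≢ x) → LinearlyIndependent (x ∷ B)
independent-∷ {x = x} {B} independent x∉span = λ where
    (true ∷ a)  (true ∷ a′)  eq → cong (true ∷_) (independent a a′ (⊕-cancelˡ x eq))
    (false ∷ a) (false ∷ a′) eq → cong (false ∷_) (independent a a′ eq)
    (true ∷ a)  (false ∷ a′) eq → ⊥-elim (x∉span (a′ ⊕ a) (in-span a′ a (sym eq)))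
    (false ∷ a) (true ∷ a′)  eq → ⊥-elim (x∉span (a ⊕ a′) (in-span a a′ eq))
  where
  in-span : ∀ a a′ → linComb a B ≡ x ⊕ linComb a′ B → linComb (a ⊕ a′) B ≡ x
  in-span a a′ eq = begin
    linComb (a ⊕ a′) B               ≡⟨ linComb-⊕ a a′ B ⟩
    linComb a B ⊕ linComb a′ B       ≡⟨ sym (⊕-moveʳ (sym eq)) ⟩
    x                                ∎
    where open ≡-Reasoning

gramRepresentation : ∀ {k n} (vs : Vec (Vec Bool k) n) → GramRepresentation vs
gramRepresentation [] = record
  { code = []; basis = []; independent = λ { [] [] _ → refl }; basisGram≡gram = refl; spans = λ () }
gramRepresentation (x ∷ vs) with gramRepresentation vs
... | R with any? (λ a → ≡-dec Bool._≟_ (linComb a (GramRepresentation.basis R)) x)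
               (allVecs (GramRepresentation.dimension R))
...   | yes x∈span = let a , a-spans = satisfied x∈span in record
  { code = inSpan a code; basis = basis; independent = independent; basisGram≡gram = basisGram≡gram
  ; spans = λ { zero → sym a-spans; (suc i) → spans i } }
  where open GramRepresentation R
...   | no  x∉span = record
  { code = newBasis (x · x ∷ Vec.map (x ·_) basis) code
  ; basis = x ∷ basis
  ; independent = independent-∷ independent (λ a eq → x∉span (lose (∈-allVecs a) eq))
  ; basisGram≡gram = trans (cong (_ ∷_) (cong (zipWith _∷_ _) basisGram≡gram)) (sym (gram-∷ x basis))
  ; spans = λ where
      zero    → sym (trans (cong (x ⊕_) (linComb-zero basis)) (⊕-identityʳ x))
      (suc i) → trans (spans i) (cong (λ a → linComb a (x ∷ basis))
                                      (sym (lookup-map i (false ∷_) (coordinates code))))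
  }
  where open GramRepresentation R

gramCode-complete : ∀ {k n} (vs : Vec (Vec Bool k) n) →
                    Σ ℕ λ r → r ≤ k × Σ (GramCode n r) λ c →
                    ∀ i j → decodeGram c i j ≡ Vec.lookup vs i · Vec.lookup vs j
gramCode-complete vs = dimension , independent⇒≤ basis independent , code , λ i j → begin
  bilinearForm (basisGram code) (coordinate i) (coordinate j)
    ≡⟨ cong (λ G → bilinearForm G (coordinate i) (coordinate j)) basisGram≡gram ⟩
  bilinearForm (gram basis) (coordinate i) (coordinate j)
    ≡⟨ bilinearForm-gram basis (coordinate i) (coordinate j) ⟩
  linComb (coordinate i) basis · linComb (coordinate j) basis
    ≡⟨ sym (cong₂ _·_ (spans i) (spans j)) ⟩
  Vec.lookup vs i · Vec.lookup vs j ∎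
  where
  open GramRepresentation (gramRepresentation vs)
  open ≡-Reasoning
  coordinate : Fin _ → Vec Bool dimension
  coordinate = Vec.lookup (coordinates code)

allGramCodes : ∀ n r → List (GramCode n r)
allGramCodes zero    zero    = [] ∷ []
allGramCodes zero    (suc r) = []
allGramCodes (suc n) zero    = List.map (inSpan []) (allGramCodes n zero)
allGramCodes (suc n) (suc r) = cartesianProductWith inSpan   (allVecs (suc r)) (allGramCodes n (suc r))
                            ++ cartesianProductWith newBasis (allVecs (suc r)) (allGramCodes n r)

∈-allGramCodes : ∀ {n r} (c : GramCode n r) → c ∈ allGramCodes n r
∈-allGramCodes []                         = here refl
∈-allGramCodes {r = zero}  (inSpan [] c)  = ∈-map⁺ (inSpan []) (∈-allGramCodes c)
∈-allGramCodes {r = suc r} (inSpan a c)   =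
  ∈-++⁺ˡ (∈-cartesianProductWith⁺ inSpan (∈-allVecs a) (∈-allGramCodes c))
∈-allGramCodes (newBasis a c) =
  ∈-++⁺ʳ _ (∈-cartesianProductWith⁺ newBasis (∈-allVecs a) (∈-allGramCodes c))

numGramCodes : ℕ → ℕ → ℕ
numGramCodes n r = length (allGramCodes n r)

numGramCodes-zero : ∀ n → numGramCodes n zero ≡ 1
numGramCodes-zero zero    = refl
numGramCodes-zero (suc n) = trans (length-map (inSpan []) (allGramCodes n zero)) (numGramCodes-zero n)

numGramCodes-suc : ∀ n r →
  numGramCodes (suc n) (suc r) ≡ 2 ^ suc r * numGramCodes n (suc r) + 2 ^ suc r * numGramCodes n r
numGramCodes-suc n r = begin
  length (inSpans ++ newBases)              ≡⟨ length-++ inSpans ⟩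
  length inSpans + length newBases          ≡⟨ cong₂ _+_ (count inSpan (allGramCodes n (suc r)))
                                                         (count newBasis (allGramCodes n r)) ⟩
  2 ^ suc r * numGramCodes n (suc r) + 2 ^ suc r * numGramCodes n r ∎
  where
  open ≡-Reasoning
  inSpans newBases : List (GramCode (suc n) (suc r))
  inSpans  = cartesianProductWith inSpan   (allVecs (suc r)) (allGramCodes n (suc r))
  newBases = cartesianProductWith newBasis (allVecs (suc r)) (allGramCodes n r)
  count : ∀ {A B : Set} (f : _ → A → B) xs →
          length (cartesianProductWith f (allVecs (suc r)) xs) ≡ 2 ^ suc r * length xs
  count f xs = trans (length-cartesianProductWith f (allVecs (suc r)) xs)
                     (cong (_* length xs) (length-allVecs (suc r)))

numGramCodes-> : ∀ n r → n < r → numGramCodes n r ≡ 0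
numGramCodes-> zero    (suc r) _         = refl
numGramCodes-> (suc n) (suc r) (s≤s n<r)
  rewrite numGramCodes-suc n r | numGramCodes-> n (suc r) (m≤n⇒m≤1+n n<r) | numGramCodes-> n r n<r
  = cong₂ _+_ (*-zeroʳ (2 ^ suc r)) (*-zeroʳ (2 ^ suc r))

-- Σ_{j<r} (n ∸ j) = r (n ∸ r) + r (r + 1) / 2: a new basis vector found at dimension j costs
-- j + 1 bits and each of the n ∸ r vectors in the span at most r bits.
gramExponent : ℕ → ℕ → ℕ
gramExponent n zero    = 0
gramExponent n (suc r) = gramExponent n r + (n ∸ r)

-- The factor n ^ (n ∸ r) accounts for the positions of the vectors lying in the span.
gramCodeBound : ℕ → ℕ → ℕ
gramCodeBound n r = n ^ (n ∸ r) * 2 ^ gramExponent n r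

gramExponent-suc : ∀ {n r} → r ≤ n → gramExponent (suc n) r ≡ gramExponent n r + r
gramExponent-suc {n} {zero}  _   = refl
gramExponent-suc {n} {suc r} r<n
  rewrite gramExponent-suc (<⇒≤ r<n) | +-∸-assoc 1 (<⇒≤ r<n) =
  solve 3 (λ e r d → (e :+ r) :+ (con 1 :+ d) := (e :+ d) :+ (con 1 :+ r)) refl
        (gramExponent n r) r (n ∸ r)

gramExponent-step : ∀ {n r} → r ≤ n → gramExponent n r + suc r ≤ gramExponent (suc n) (suc r)
gramExponent-step {n} {r} r≤n rewrite gramExponent-suc r≤n | +-∸-assoc 1 r≤n = begin
  gramExponent n r + suc r            ≡⟨ +-suc (gramExponent n r) r ⟩
  suc (gramExponent n r + r)          ≤⟨ m≤m+n _ (n ∸ r) ⟩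
  suc (gramExponent n r + r) + (n ∸ r) ≡⟨ sym (+-suc (gramExponent n r + r) (n ∸ r)) ⟩
  gramExponent n r + r + suc (n ∸ r)  ∎
  where open ≤-Reasoning

1≤n^n : ∀ n → 1 ≤ n ^ n
1≤n^n zero    = ≤-refl
1≤n^n (suc n) = m^n>0 (suc n) (suc n)

2^*2^ : ∀ a b → 2 ^ a * 2 ^ b ≡ 2 ^ (a + b)
2^*2^ a b = sym (^-distribˡ-+-* 2 a b)

2^-absorb : ∀ a x b → 2 ^ a * (x * 2 ^ b) ≡ x * 2 ^ (b + a)
2^-absorb a x b = begin
  2 ^ a * (x * 2 ^ b)  ≡⟨ solve 3 (λ p x q → p :* (x :* q) := x :* (q :* p)) refl (2 ^ a) x (2 ^ b) ⟩
  x * (2 ^ b * 2 ^ a)  ≡⟨ cong (x *_) (2^*2^ b a) ⟩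
  x * 2 ^ (b + a)      ∎
  where open ≡-Reasoning

numGramCodes≤gramCodeBound : ∀ n r → numGramCodes n r ≤ gramCodeBound n r
numGramCodes≤gramCodeBound zero    zero    = ≤-refl
numGramCodes≤gramCodeBound zero    (suc r) = z≤n
numGramCodes≤gramCodeBound (suc n) zero    rewrite numGramCodes-zero (suc n) =
  *-monoˡ-≤ 1 (1≤n^n (suc n))
numGramCodes≤gramCodeBound (suc n) (suc r) with <-cmp r n
... | tri> _ _ n<r rewrite numGramCodes-> (suc n) (suc r) (s≤s n<r) = z≤n
... | tri≈ _ refl _
  rewrite numGramCodes-suc n n | numGramCodes-> n (suc n) ≤-refl = begin
    2 ^ suc n * 0 + 2 ^ suc n * numGramCodes n n ≡⟨ cong (_+ 2 ^ suc n * numGramCodes n n) (*-zeroʳ (2 ^ suc n)) ⟩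
    2 ^ suc n * numGramCodes n n                 ≤⟨ *-monoʳ-≤ (2 ^ suc n) (numGramCodes≤gramCodeBound n n) ⟩
    2 ^ suc n * gramCodeBound n n                ≡⟨ cong (λ z → 2 ^ suc n * (n ^ z * 2 ^ gramExponent n n)) (n∸n≡0 n) ⟩
    2 ^ suc n * (1 * 2 ^ gramExponent n n)       ≡⟨ cong (2 ^ suc n *_) (*-identityˡ (2 ^ gramExponent n n)) ⟩
    2 ^ suc n * 2 ^ gramExponent n n             ≡⟨ trans (2^*2^ (suc n) _) (cong (2 ^_) (+-comm (suc n) (gramExponent n n))) ⟩
    2 ^ (gramExponent n n + suc n)               ≤⟨ ^-monoʳ-≤ 2 (gramExponent-step {n} ≤-refl) ⟩
    2 ^ gramExponent (suc n) (suc n)             ≡⟨ sym (*-identityˡ _) ⟩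
    1 * 2 ^ gramExponent (suc n) (suc n)         ≡⟨ cong (λ z → suc n ^ z * 2 ^ gramExponent (suc n) (suc n)) (sym (n∸n≡0 n)) ⟩
    gramCodeBound (suc n) (suc n)                ∎
  where open ≤-Reasoning
... | tri< r<n _ _ rewrite numGramCodes-suc n r = begin
    2 ^ suc r * numGramCodes n (suc r) + 2 ^ suc r * numGramCodes n r
      ≤⟨ +-mono-≤ (*-monoʳ-≤ (2 ^ suc r) (numGramCodes≤gramCodeBound n (suc r)))
                  (*-monoʳ-≤ (2 ^ suc r) (numGramCodes≤gramCodeBound n r)) ⟩
    2 ^ suc r * gramCodeBound n (suc r) + 2 ^ suc r * gramCodeBound n r
      ≡⟨ cong₂ _+_ (2^-absorb (suc r) (n ^ (n ∸ suc r)) (gramExponent n (suc r)))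
                   (2^-absorb (suc r) (n ^ (n ∸ r)) (gramExponent n r)) ⟩
    n ^ (n ∸ suc r) * 2 ^ (gramExponent n (suc r) + suc r) + n ^ (n ∸ r) * 2 ^ (gramExponent n r + suc r)
      ≤⟨ +-mono-≤ (≤-reflexive (cong (λ z → n ^ (n ∸ suc r) * 2 ^ z) (sym (gramExponent-suc r<n))))
                  (*-monoʳ-≤ (n ^ (n ∸ r)) (^-monoʳ-≤ 2 (gramExponent-step (<⇒≤ r<n)))) ⟩
    n ^ (n ∸ suc r) * E + n ^ (n ∸ r) * E
      ≡⟨ sym (*-distribʳ-+ E (n ^ (n ∸ suc r)) (n ^ (n ∸ r))) ⟩
    (n ^ (n ∸ suc r) + n ^ (n ∸ r)) * E
      ≤⟨ *-monoˡ-≤ E (subst (λ z → n ^ (n ∸ suc r) + n ^ z ≤ suc n ^ z) (sym n∸r≡suc) (binomial-step (n ∸ suc r))) ⟩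
    suc n ^ (n ∸ r) * E ∎
  where
  open ≤-Reasoning
  E : ℕ
  E = 2 ^ gramExponent (suc n) (suc r)
  n∸r≡suc : n ∸ r ≡ suc (n ∸ suc r)
  n∸r≡suc = +-∸-assoc 1 r<n
  binomial-step : ∀ d → n ^ d + n ^ suc d ≤ suc n ^ suc d
  binomial-step d = +-mono-≤ (^-monoˡ-≤ d (n≤1+n n)) (*-monoʳ-≤ n (^-monoˡ-≤ d (n≤1+n n)))

numGramCodesUpTo : ℕ → ℕ → ℕ
numGramCodesUpTo n zero    = numGramCodes n zero
numGramCodesUpTo n (suc K) = numGramCodes n (suc K) + numGramCodesUpTo n K

gramCodeBound-step : ∀ {n j} → j < n → n ≤ 2 ^ (n ∸ j) → gramCodeBound n j ≤ gramCodeBound n (suc j)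
gramCodeBound-step {n} {j} j<n n≤2^[n∸j] = begin
  n ^ (n ∸ j) * 2 ^ E                    ≡⟨ cong (λ z → n ^ z * 2 ^ E) (+-∸-assoc 1 j<n) ⟩
  n * n ^ d * 2 ^ E                      ≡⟨ solve 3 (λ a b c → a :* b :* c := b :* (c :* a)) refl n (n ^ d) (2 ^ E) ⟩
  n ^ d * (2 ^ E * n)                    ≤⟨ *-monoʳ-≤ (n ^ d) (*-monoʳ-≤ (2 ^ E) n≤2^[n∸j]) ⟩
  n ^ d * (2 ^ E * 2 ^ (n ∸ j))          ≡⟨ cong (n ^ d *_) (2^*2^ E (n ∸ j)) ⟩
  n ^ d * 2 ^ gramExponent n (suc j)     ∎
  where
  open ≤-Reasoning
  d : ℕ
  d = n ∸ suc j
  E : ℕ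
  E = gramExponent n j

gramCodeBound-mono : ∀ {n j K} → K ≤ n → n ≤ 2 ^ (n ∸ K) → j ≤ K → gramCodeBound n j ≤ gramCodeBound n K
gramCodeBound-mono {K = zero}  _   _          z≤n  = ≤-refl
gramCodeBound-mono {n} {j} {suc K} K<n n≤2^[n∸K] j≤K with m≤n⇒m<n∨m≡n j≤K
... | inj₂ refl = ≤-refl
... | inj₁ j<1+K = ≤-trans
  (gramCodeBound-mono (<⇒≤ K<n) n≤2^[n∸K]′ (≤-pred j<1+K))
  (gramCodeBound-step K<n n≤2^[n∸K]′)
  where
  n≤2^[n∸K]′ : n ≤ 2 ^ (n ∸ K)
  n≤2^[n∸K]′ = ≤-trans n≤2^[n∸K] (^-monoʳ-≤ 2 (∸-monoʳ-≤ n (n≤1+n K)))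

numGramCodesUpTo≤ : ∀ {n K} → K ≤ n → n ≤ 2 ^ (n ∸ K) →
                    numGramCodesUpTo n K ≤ suc K * gramCodeBound n K
numGramCodesUpTo≤ {n} {K} K≤n n≤2^[n∸K] = upTo K ≤-refl
  where
  term : ∀ {j} → j ≤ K → numGramCodes n j ≤ gramCodeBound n K
  term j≤K = ≤-trans (numGramCodes≤gramCodeBound n _) (gramCodeBound-mono K≤n n≤2^[n∸K] j≤K)
  upTo : ∀ J → J ≤ K → numGramCodesUpTo n J ≤ suc J * gramCodeBound n K
  upTo zero    J≤K = ≤-trans (term J≤K) (≤-reflexive (sym (+-identityʳ _)))
  upTo (suc J) J≤K = +-mono-≤ (term J≤K) (upTo J (≤-trans (n≤1+n J) J≤K))

invertAll-undo : ∀ {n k} (D : Digraph n) (Xs : Vec (VSubset n) k) i j →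
                 D i j ≡ (if coParity Xs i j then invertAll D Xs j i else invertAll D Xs i j)
invertAll-undo D Xs i j
  rewrite invertAll-coParity D Xs i j | invertAll-coParity D Xs j i | coParity-comm Xs j i
  with coParity Xs i j
... | true  = refl
... | false = refl

memberships : ∀ {n k} → Vec (VSubset n) k → Vec (Vec Bool k) n
memberships Xs = Vec.tabulate (λ i → Vec.map (λ X → X i) Xs)

coParity≡memberships· : ∀ {n k} (Xs : Vec (VSubset n) k) i j →
  coParity Xs i j ≡ Vec.lookup (memberships Xs) i · Vec.lookup (memberships Xs) j
coParity≡memberships· Xs i j
  rewrite lookup∘tabulate (λ i → Vec.map (λ X → X i) Xs) i
        | lookup∘tabulate (λ i → Vec.map (λ X → X i) Xs) j = coParity≡· Xs
  where
  coParity≡· : ∀ {k} (Xs : Vec (VSubset _) k) → coParity Xs i j ≡ Vec.map (λ X → X i) Xs · Vec.map (λ X → X j) Xs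
  coParity≡· []       = refl
  coParity≡· (X ∷ Xs) = cong ((X i ∧ X j) xor_) (coParity≡· Xs)

fromCodes : ∀ {n r} → RankCode n → GramCode n r → Digraph n
fromCodes c g i j = if decodeGram g i j then rankOrder c j i else rankOrder c i j

candidates : ∀ n r → List (Digraph n)
candidates n r = cartesianProductWith fromCodes (allRankCodes n) (allGramCodes n r)

candidatesUpTo : ∀ n → ℕ → List (Digraph n)
candidatesUpTo n zero    = candidates n zero
candidatesUpTo n (suc K) = candidates n (suc K) ++ candidatesUpTo n K

length-candidates : ∀ n r → length (candidates n r) ≡ n ! * numGramCodes n r
length-candidates n r =
  trans (length-cartesianProductWith fromCodes (allRankCodes n) (allGramCodes n r))
        (cong (_* numGramCodes n r) (length-allRankCodes n))

length-candidatesUpTo : ∀ n K → length (candidatesUpTo n K) ≡ n ! * numGramCodesUpTo n K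
length-candidatesUpTo n zero    = length-candidates n zero
length-candidatesUpTo n (suc K) = begin
  length (candidates n (suc K) ++ candidatesUpTo n K)
    ≡⟨ length-++ (candidates n (suc K)) ⟩
  length (candidates n (suc K)) + length (candidatesUpTo n K)
    ≡⟨ cong₂ _+_ (length-candidates n (suc K)) (length-candidatesUpTo n K) ⟩
  n ! * numGramCodes n (suc K) + n ! * numGramCodesUpTo n K
    ≡⟨ sym (*-distribˡ-+ (n !) _ _) ⟩
  n ! * numGramCodesUpTo n (suc K) ∎
  where open ≡-Reasoning

∈-candidatesUpTo : ∀ {n r K D} → r ≤ K → D ∈ candidates n r → D ∈ candidatesUpTo n K
∈-candidatesUpTo {K = zero}  r≤0 D∈ rewrite n≤0⇒n≡0 r≤0 = D∈
∈-candidatesUpTo {K = suc K} r≤K D∈ with m≤n⇒m<n∨m≡n r≤K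
... | inj₂ refl  = ∈-++⁺ˡ D∈
... | inj₁ r<1+K = ∈-++⁺ʳ (candidates _ (suc K)) (∈-candidatesUpTo (≤-pred r<1+K) D∈)

SameArcs : ∀ {n} → Tournament n → Digraph n → Set
SameArcs T D = ∀ i j → proj₁ T i j ≡ D i j

sameArcs? : ∀ {n} (T : Tournament n) D → Dec (SameArcs T D)
sameArcs? T D = Fin.all? (λ i → Fin.all? (λ j → proj₁ T i j Bool.≟ D i j))

fromCodes-undoes-inversion : ∀ {n k r} (D : Digraph n) (Xs : Vec (VSubset n) k) {c : RankCode n} {g : GramCode n r} →
  (∀ i j → invertAll D Xs i j ≡ rankOrder c i j) →
  (∀ i j → decodeGram g i j ≡ Vec.lookup (memberships Xs) i · Vec.lookup (memberships Xs) j) →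
  ∀ i j → D i j ≡ fromCodes c g i j
fromCodes-undoes-inversion D Xs A≡rankOrder g≡Gram i j
  rewrite invertAll-undo D Xs i j | g≡Gram i j | sym (coParity≡memberships· Xs i j)
        | A≡rankOrder i j | A≡rankOrder j i = refl

decyclable⇒candidate : ∀ {n k} K (T : Tournament n) (Xs : Vec (VSubset n) k) →
                       IsDecyclingFamily (proj₁ T) Xs → k ≤ K → Any (SameArcs T) (candidatesUpTo n K)
decyclable⇒candidate K (D , isTournament) Xs acyclic k≤K =
  let A-tournament    = invertAll-tournament Xs isTournament
      c , A≡rankOrder = transitiveTournament⇒rankOrder A-tournament
                          (acyclic-tournament-transitive A-tournament acyclic)
      r , r≤k , g , g≡Gram = gramCode-complete (memberships Xs)
  in lose (∈-candidatesUpTo (≤-trans r≤k k≤K)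
             (∈-cartesianProductWith⁺ fromCodes (∈-allRankCodes c) (∈-allGramCodes g)))
          (fromCodes-undoes-inversion D Xs {c} {g} A≡rankOrder g≡Gram)

length-filter-¬? : ∀ {A : Set} {P : A → Set} (P? : Decidable P) xs →
                   length (filter P? xs) + length (filter (¬? ∘ P?) xs) ≡ length xs
length-filter-¬? P? []       = refl
length-filter-¬? P? (x ∷ xs) with P? x
... | yes _ = cong suc (length-filter-¬? P? xs)
... | no  _ = trans (+-suc _ _) (cong suc (length-filter-¬? P? xs))

tournamentsWithInv> : ∀ n K → Σ (List (Tournament n)) λ good →
  AllPairs Differ good × All (λ T → InvSatisfies (proj₁ T) (K <_)) good ×
  numTournaments n ≤ length good + n ! * numGramCodesUpTo n K
tournamentsWithInv> n K = good , AllPairs.filter⁺ _ (allTournaments-differ n) , good-inv , counted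
  where
  covered? : Decidable (λ T → Any (SameArcs T) (candidatesUpTo n K))
  covered? T = any? (sameArcs? T) (candidatesUpTo n K)
  good : List (Tournament n)
  good = filter (¬? ∘ covered?) (allTournaments n)
  bad : List (Tournament n)
  bad  = filter covered? (allTournaments n)

  good-inv : All (λ T → InvSatisfies (proj₁ T) (K <_)) good
  good-inv = All.map (λ {T} uncovered k Xs acyclic → ≰⇒> (uncovered ∘ decyclable⇒candidate K T Xs acyclic))
                     (All.all-filter (¬? ∘ covered?) (allTournaments n))

  few-bad : length bad ≤ n ! * numGramCodesUpTo n K
  few-bad = ≤-trans
    (pigeonhole SameArcs
       (AllPairs.filter⁺ covered? (AllPairs.map (λ {T} {U} → differ⇒disjoint {T} {U}) (allTournaments-differ n)))
       (All.all-filter covered? (allTournaments n)))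
    (≤-reflexive (length-candidatesUpTo n K))
    where
    differ⇒disjoint : ∀ {T U} → Differ T U → ∀ {D} → SameArcs T D → SameArcs U D → ⊥
    differ⇒disjoint (i , j , Tij≢Uij) T≡D U≡D = Tij≢Uij (trans (T≡D i j) (sym (U≡D i j)))

  counted : numTournaments n ≤ length good + n ! * numGramCodesUpTo n K
  counted = begin
    numTournaments n                                  ≡⟨ sym (length-allTournaments n) ⟩
    length (allTournaments n)                         ≡⟨ sym (length-filter-¬? covered? (allTournaments n)) ⟩
    length bad + length good                          ≤⟨ +-monoˡ-≤ (length good) few-bad ⟩
    n ! * numGramCodesUpTo n K + length good          ≡⟨ +-comm _ (length good) ⟩
    length good + n ! * numGramCodesUpTo n K          ∎
    where open ≤-Reasoning

-- Σ_{j<K} (K + t ∸ j) is the sum of t + 1, …, K + t.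
gramExponent+C2 : ∀ K t → gramExponent (K + t) K + suc t C 2 ≡ suc (K + t) C 2
gramExponent+C2 zero    t = refl
gramExponent+C2 (suc K) t = begin
  gramExponent (suc K + t) K + (suc K + t ∸ K) + suc t C 2
    ≡⟨ cong (λ d → gramExponent (suc K + t) K + d + suc t C 2) (trans (cong (_∸ K) (sym (+-suc K t))) (m+n∸m≡n K (suc t))) ⟩
  gramExponent (suc K + t) K + suc t + suc t C 2
    ≡⟨ +-assoc (gramExponent (suc K + t) K) (suc t) (suc t C 2) ⟩
  gramExponent (suc K + t) K + (suc t + suc t C 2)
    ≡⟨ cong₂ _+_ (cong (λ n → gramExponent n K) (sym (+-suc K t))) (sym (suc[n]C2 (suc t))) ⟩
  gramExponent (K + suc t) K + suc (suc t) C 2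
    ≡⟨ gramExponent+C2 K (suc t) ⟩
  suc (K + suc t) C 2
    ≡⟨ cong (λ n → suc n C 2) (+-suc K t) ⟩
  suc (suc K + t) C 2 ∎
  where open ≡-Reasoning

2*[1+n]C2 : ∀ n → 2 * (suc n C 2) ≡ suc n * n
2*[1+n]C2 zero    = refl
2*[1+n]C2 (suc n) = begin
  2 * (suc (suc n) C 2)        ≡⟨ cong (2 *_) (suc[n]C2 (suc n)) ⟩
  2 * (suc n + suc n C 2)      ≡⟨ *-distribˡ-+ 2 (suc n) (suc n C 2) ⟩
  2 * suc n + 2 * (suc n C 2)  ≡⟨ cong (2 * suc n +_) (2*[1+n]C2 n) ⟩
  2 * suc n + suc n * n        ≡⟨ solve 1 (λ n → con 2 :* (con 1 :+ n) :+ (con 1 :+ n) :* n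
                                             := (con 2 :+ n) :* (con 1 :+ n)) refl n ⟩
  suc (suc n) * suc n          ∎
  where open ≡-Reasoning

m*m≤n*n⇒m≤n : ∀ {m n} → m * m ≤ n * n → m ≤ n
m*m≤n*n⇒m≤n m*m≤n*n = ≮⇒≥ (λ n<m → <⇒≱ (*-mono-< n<m n<m) m*m≤n*n)

^-square : ∀ m n → m ^ n * m ^ n ≡ m ^ (2 * n)
^-square m n = trans (sym (^-distribˡ-+-* m n n)) (cong (λ k → m ^ (n + k)) (sym (+-identityʳ n)))

n^n≤2^[1+t]C2 : ∀ {n t} → n ^ (2 * n) < 2 ^ (t * t) → n ^ n ≤ 2 ^ (suc t C 2)
n^n≤2^[1+t]C2 {n} {t} n^2n<2^tt = m*m≤n*n⇒m≤n (begin
  n ^ n * n ^ n                  ≡⟨ ^-square n n ⟩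
  n ^ (2 * n)                    ≤⟨ <⇒≤ n^2n<2^tt ⟩
  2 ^ (t * t)                    ≤⟨ ^-monoʳ-≤ 2 (*-monoˡ-≤ t (n≤1+n t)) ⟩
  2 ^ (suc t * t)                ≡⟨ cong (2 ^_) (sym (2*[1+n]C2 t)) ⟩
  2 ^ (2 * (suc t C 2))          ≡⟨ sym (^-square 2 (suc t C 2)) ⟩
  2 ^ (suc t C 2) * 2 ^ (suc t C 2) ∎)
  where open ≤-Reasoning

-- Multiplying by 2 ^ n turns the target 2 ^ (n C 2) into 2 ^ (suc n C 2), which splits as
-- 2 ^ gramExponent n K · 2 ^ (suc t C 2).
*2^gramExponent≤2^nC2 : ∀ {X K t n} → K + t ≡ n → X * 2 ^ n ≤ 2 ^ (suc t C 2) →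
                        X * 2 ^ gramExponent n K ≤ 2 ^ (n C 2)
*2^gramExponent≤2^nC2 {X} {K} {t} {n} refl X2^n≤ = *-cancelʳ-≤ _ _ (2 ^ n) {{m^n≢0 2 n}} (begin
  X * 2 ^ E * 2 ^ n              ≡⟨ solve 3 (λ x e p → x :* e :* p := x :* p :* e) refl X (2 ^ E) (2 ^ n) ⟩
  X * 2 ^ n * 2 ^ E              ≤⟨ *-monoˡ-≤ (2 ^ E) X2^n≤ ⟩
  2 ^ (suc t C 2) * 2 ^ E        ≡⟨ 2^*2^ (suc t C 2) E ⟩
  2 ^ (suc t C 2 + E)            ≡⟨ cong (2 ^_) (trans (+-comm (suc t C 2) E) (gramExponent+C2 K t)) ⟩
  2 ^ (suc n C 2)                ≡⟨ cong (2 ^_) (suc[n]C2 n) ⟩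
  2 ^ (n + n C 2)                ≡⟨ trans (sym (2^*2^ n (n C 2))) (*-comm (2 ^ n) (2 ^ (n C 2))) ⟩
  2 ^ (n C 2) * 2 ^ n            ∎)
  where
  open ≤-Reasoning
  E : ℕ
  E = gramExponent n K

few-candidates : ∀ {m n K t} → K + t ≡ n → n ^ (2 * n) < 2 ^ (t * t) → n ≤ 2 ^ t →
                 m * n ! * suc n * n ^ t * 2 ^ n ≤ n ^ n →
                 m * (n ! * numGramCodesUpTo n K) ≤ numTournaments n
few-candidates {m} {n} {K} {t} refl n^2n<2^tt n≤2^t small = begin
  m * (n ! * numGramCodesUpTo n K)                   ≤⟨ *-monoʳ-≤ m (*-monoʳ-≤ (n !) (numGramCodesUpTo≤ K≤n n≤2^[n∸K])) ⟩
  m * (n ! * (suc K * (n ^ (n ∸ K) * 2 ^ E)))        ≡⟨ cong (λ d → m * (n ! * (suc K * (n ^ d * 2 ^ E)))) n∸K≡t ⟩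
  m * (n ! * (suc K * (n ^ t * 2 ^ E)))              ≡⟨ solve 5 (λ a b c d e → a :* (b :* (c :* (d :* e)))
                                                                  := a :* b :* c :* d :* e) refl m (n !) (suc K) (n ^ t) (2 ^ E) ⟩
  X * 2 ^ E                                          ≤⟨ *2^gramExponent≤2^nC2 {X} {K} {t} refl X2^n≤ ⟩
  2 ^ (n C 2)                                        ∎
  where
  open ≤-Reasoning
  E : ℕ
  E = gramExponent n K
  X : ℕ
  X = m * n ! * suc K * n ^ t
  K≤n : K ≤ n
  K≤n = m≤m+n K t
  n∸K≡t : n ∸ K ≡ t
  n∸K≡t = m+n∸m≡n K t
  n≤2^[n∸K] : n ≤ 2 ^ (n ∸ K)
  n≤2^[n∸K] = subst (λ d → n ≤ 2 ^ d) (sym n∸K≡t) n≤2^t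
  X2^n≤ : X * 2 ^ n ≤ 2 ^ (suc t C 2)
  X2^n≤ = ≤-trans (*-monoˡ-≤ (2 ^ n) (*-monoˡ-≤ (n ^ t) (*-monoʳ-≤ (m * n !) (s≤s K≤n))))
                  (≤-trans small (n^n≤2^[1+t]C2 {n} {t} n^2n<2^tt))

crossing : (P : ℕ → Set) → (∀ x → Dec (P x)) → ¬ P 0 → ∀ {b} → P b →
           Σ ℕ λ s → s < b × ¬ P s × P (suc s)
crossing P P? ¬P0 {zero}  P0   = ⊥-elim (¬P0 P0)
crossing P P? ¬P0 {suc b} Pb+1 with P? b
... | no  ¬Pb = b , ≤-refl , ¬Pb , Pb+1
... | yes Pb  = let s , s<b , ¬Ps , Ps+1 = crossing P P? ¬P0 Pb in s , m<n⇒m<1+n s<b , ¬Ps , Ps+1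

^-distribʳ-* : ∀ a b n → (a * b) ^ n ≡ a ^ n * b ^ n
^-distribʳ-* a b zero    = refl
^-distribʳ-* a b (suc n) rewrite ^-distribʳ-* a b n =
  solve 4 (λ a b x y → (a :* b) :* (x :* y) := (a :* x) :* (b :* y)) refl a b (a ^ n) (b ^ n)

n<2^n : ∀ n → n < 2 ^ n
n<2^n zero    = s≤s z≤n
n<2^n (suc n) = begin-strict
  suc n          ≤⟨ n<2^n n ⟩
  2 ^ n          <⟨ m<m+n (2 ^ n) (m^n>0 2 n) ⟩
  2 ^ n + 2 ^ n  ≡⟨ cong (2 ^ n +_) (sym (+-identityʳ (2 ^ n))) ⟩
  2 ^ suc n      ∎
  where open ≤-Reasoning

-- The first three terms of the binomial expansion of (a + 1) ^ k, scaled by a ^ (k + 2).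
binomial-lower-bound : ∀ a k → a ^ k * (a * a + k * a + k C 2) ≤ a * a * suc a ^ k
binomial-lower-bound a zero    = ≤-reflexive (solve 1 (λ x → con 1 :* (x :+ con 0 :+ con 0) := x :* con 1) refl (a * a))
binomial-lower-bound a (suc k) rewrite suc[n]C2 k = begin
  a * a ^ k * (a * a + suc k * a + (k + c))
    ≤⟨ m≤m+n _ (a ^ k * c) ⟩
  a * a ^ k * (a * a + suc k * a + (k + c)) + a ^ k * c
    ≡⟨ solve 4 (λ a y k c → a :* y :* (a :* a :+ (con 1 :+ k) :* a :+ (k :+ c)) :+ y :* c
                          := (con 1 :+ a) :* (y :* (a :* a :+ k :* a :+ c))) refl a (a ^ k) k c ⟩
  suc a * (a ^ k * (a * a + k * a + c))
    ≤⟨ *-monoʳ-≤ (suc a) (binomial-lower-bound a k) ⟩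
  suc a * (a * a * suc a ^ k)
    ≡⟨ solve 3 (λ a x y → (con 1 :+ a) :* (x :* y) := x :* ((con 1 :+ a) :* y)) refl a (a * a) (suc a ^ k) ⟩
  a * a * (suc a * suc a ^ k) ∎
  where
  open ≤-Reasoning
  c : ℕ
  c = k C 2

n*n≤4*nC2 : ∀ n → 2 ≤ n → n * n ≤ 4 * (n C 2)
n*n≤4*nC2 (suc n) (s≤s 1≤n) = begin
  suc n * suc n          ≤⟨ *-monoʳ-≤ (suc n) (+-monoˡ-≤ n 1≤n) ⟩
  suc n * (n + n)        ≡⟨ solve 1 (λ n → (con 1 :+ n) :* (n :+ n) := con 2 :* ((con 1 :+ n) :* n)) refl n ⟩
  2 * (suc n * n)        ≡⟨ cong (2 *_) (sym (2*[1+n]C2 n)) ⟩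
  2 * (2 * (suc n C 2))  ≡⟨ sym (*-assoc 2 2 (suc n C 2)) ⟩
  4 * (suc n C 2)        ∎
  where open ≤-Reasoning

-- (1 + 1/n) ^ n ≥ 1 + 1 + (n C 2) / n ^ 2 ≥ 9/4.
9*n^n≤4*[1+n]^n : ∀ n → 2 ≤ n → 9 * n ^ n ≤ 4 * suc n ^ n
9*n^n≤4*[1+n]^n n 2≤n = *-cancelʳ-≤ (9 * n ^ n) (4 * suc n ^ n) (n * n) {{nonZero}} (begin
  9 * n ^ n * (n * n)                        ≡⟨ solve 2 (λ y s → con 9 :* y :* s := y :* (con 8 :* s :+ s)) refl (n ^ n) (n * n) ⟩
  n ^ n * (8 * (n * n) + n * n)              ≤⟨ *-monoʳ-≤ (n ^ n) (+-monoʳ-≤ (8 * (n * n)) (n*n≤4*nC2 n 2≤n)) ⟩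
  n ^ n * (8 * (n * n) + 4 * (n C 2))        ≡⟨ solve 3 (λ y n c → y :* (con 8 :* (n :* n) :+ con 4 :* c)
                                                              := con 4 :* (y :* (n :* n :+ n :* n :+ c))) refl (n ^ n) n (n C 2) ⟩
  4 * (n ^ n * (n * n + n * n + n C 2))      ≤⟨ *-monoʳ-≤ 4 (binomial-lower-bound n n) ⟩
  4 * (n * n * suc n ^ n)                    ≡⟨ solve 2 (λ s y → con 4 :* (s :* y) := con 4 :* y :* s) refl (n * n) (suc n ^ n) ⟩
  4 * suc n ^ n * (n * n)                    ∎)
  where
  open ≤-Reasoning
  nonZero : NonZero (n * n)
  nonZero = >-nonZero (*-mono-≤ (≤-trans (s≤s z≤n) 2≤n) (≤-trans (s≤s z≤n) 2≤n))

n!*9^n≤3*4^n*n^n : ∀ n → n ! * 9 ^ n ≤ 3 * 4 ^ n * n ^ n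
n!*9^n≤3*4^n*n^n zero                 = m≤m+n 1 2
n!*9^n≤3*4^n*n^n (suc zero)           = m≤m+n 9 3
n!*9^n≤3*4^n*n^n (suc (suc zero))     = m≤m+n 162 30
n!*9^n≤3*4^n*n^n (suc n@(suc (suc _))) = begin
  (suc n * n !) * (9 * 9 ^ n)           ≡⟨ solve 3 (λ s f p → (s :* f) :* (con 9 :* p) := s :* (con 9 :* (f :* p))) refl (suc n) (n !) (9 ^ n) ⟩
  suc n * (9 * (n ! * 9 ^ n))           ≤⟨ *-monoʳ-≤ (suc n) (*-monoʳ-≤ 9 (n!*9^n≤3*4^n*n^n n)) ⟩
  suc n * (9 * (3 * 4 ^ n * n ^ n))     ≡⟨ solve 3 (λ s f y → s :* (con 9 :* (con 3 :* f :* y)) := s :* con 3 :* f :* (con 9 :* y)) refl (suc n) (4 ^ n) (n ^ n) ⟩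
  suc n * 3 * 4 ^ n * (9 * n ^ n)       ≤⟨ *-monoʳ-≤ (suc n * 3 * 4 ^ n) (9*n^n≤4*[1+n]^n n (s≤s (s≤s z≤n))) ⟩
  suc n * 3 * 4 ^ n * (4 * suc n ^ n)   ≡⟨ solve 3 (λ s f y → s :* con 3 :* f :* (con 4 :* y) := con 3 :* (con 4 :* f) :* (s :* y)) refl (suc n) (4 ^ n) (suc n ^ n) ⟩
  3 * (4 * 4 ^ n) * (suc n * suc n ^ n) ∎
  where open ≤-Reasoning

-- 8 ^ 6 · 2 = 524288 ≤ 531441 = 9 ^ 6.
8^n*2^q≤9^n : ∀ {n q} → 6 * q ≤ n → 8 ^ n * 2 ^ q ≤ 9 ^ n
8^n*2^q≤9^n {n} {q} 6q≤n = begin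
  8 ^ n * 2 ^ q                    ≡⟨ cong (λ z → 8 ^ z * 2 ^ q) (sym j+6q≡n) ⟩
  8 ^ (j + 6 * q) * 2 ^ q          ≡⟨ cong (_* 2 ^ q) (^-distribˡ-+-* 8 j (6 * q)) ⟩
  8 ^ j * 8 ^ (6 * q) * 2 ^ q      ≡⟨ *-assoc (8 ^ j) (8 ^ (6 * q)) (2 ^ q) ⟩
  8 ^ j * (8 ^ (6 * q) * 2 ^ q)    ≡⟨ cong (λ z → 8 ^ j * (z * 2 ^ q)) (sym (^-*-assoc 8 6 q)) ⟩
  8 ^ j * ((8 ^ 6) ^ q * 2 ^ q)    ≡⟨ cong (8 ^ j *_) (sym (^-distribʳ-* (8 ^ 6) 2 q)) ⟩
  8 ^ j * (8 ^ 6 * 2) ^ q          ≤⟨ *-mono-≤ (^-monoˡ-≤ j (m≤m+n 8 1)) (^-monoˡ-≤ q (m≤m+n 524288 7153)) ⟩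
  9 ^ j * (9 ^ 6) ^ q              ≡⟨ cong (9 ^ j *_) (^-*-assoc 9 6 q) ⟩
  9 ^ j * 9 ^ (6 * q)              ≡⟨ sym (^-distribˡ-+-* 9 j (6 * q)) ⟩
  9 ^ (j + 6 * q)                  ≡⟨ cong (9 ^_) j+6q≡n ⟩
  9 ^ n                            ∎
  where
  open ≤-Reasoning
  j : ℕ
  j = n ∸ 6 * q
  j+6q≡n : j + 6 * q ≡ n
  j+6q≡n = m∸n+n≡m 6q≤n

fourthPower : ℕ → ℕ
fourthPower x = x * x * x * x

fourthPower-suc : ∀ {L} → 6 ≤ L → fourthPower (suc L) ≤ 2 * fourthPower L
fourthPower-suc {L} 6≤L =
  subst (λ x → fourthPower (suc x) ≤ 2 * fourthPower x) (m+[n∸m]≡n 6≤L) (expanded (L ∸ 6))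
  where
  expanded : ∀ y → fourthPower (7 + y) ≤ 2 * fourthPower (6 + y)
  expanded y = begin
    fourthPower (7 + y)
      ≤⟨ m≤m+n _ slack ⟩
    fourthPower (7 + y) + slack
      ≡⟨ solve 1 (λ y → (con 7 :+ y) :* (con 7 :+ y) :* (con 7 :+ y) :* (con 7 :+ y)
                         :+ (y :* y :* y :* y :+ con 20 :* (y :* y :* y) :+ con 138 :* (y :* y) :+ con 356 :* y :+ con 191)
                     := con 2 :* ((con 6 :+ y) :* (con 6 :+ y) :* (con 6 :+ y) :* (con 6 :+ y))) refl y ⟩
    2 * fourthPower (6 + y) ∎
    where
    open ≤-Reasoning
    slack : ℕ
    slack = y * y * y * y + 20 * (y * y * y) + 138 * (y * y) + 356 * y + 191

fourthPower≤2^ : ∀ {L} → 30 ≤ L → fourthPower L ≤ 2 ^ L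
fourthPower≤2^ 30≤L = from30 (≤⇒≤′ 30≤L)
  where
  from30 : ∀ {L} → 30 ≤′ L → fourthPower L ≤ 2 ^ L
  from30 ≤′-refl                = m≤m+n 810000 1072931824
  from30 (≤′-step {L} 30≤′L)    =
    ≤-trans (fourthPower-suc (≤-trans (m≤m+n 6 24) (≤′⇒≤ 30≤′L))) (*-monoʳ-≤ 2 (from30 30≤′L))

polynomial-bound : ∀ M L → 2400 + 12 * M ≤ L →
                   288 * (suc L * suc L * suc L) + 12 * (M + 2 * suc L + 1) ≤ fourthPower L
polynomial-bound M L M≪L = begin
  288 * (suc L * suc L * suc L) + 12 * (M + 2 * suc L + 1)
    ≤⟨ +-mono-≤ (*-monoʳ-≤ 288 cube) linear ⟩
  288 * (8 * c) + (12 * M * c + 60 * c)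
    ≡⟨ solve 2 (λ M c → con 288 :* (con 8 :* c) :+ (con 12 :* M :* c :+ con 60 :* c) := (con 2364 :+ con 12 :* M) :* c) refl M c ⟩
  (2364 + 12 * M) * c
    ≤⟨ *-monoˡ-≤ c (≤-trans (+-monoˡ-≤ (12 * M) (m≤m+n 2364 36)) M≪L) ⟩
  L * c
    ≡⟨ solve 1 (λ L → L :* (L :* L :* L) := L :* L :* L :* L) refl L ⟩
  fourthPower L ∎
  where
  open ≤-Reasoning
  c : ℕ
  c = L * L * L
  1≤L : 1 ≤ L
  1≤L = ≤-trans (s≤s z≤n) M≪L
  1+L≤2L : suc L ≤ 2 * L
  1+L≤2L = subst (suc L ≤_) (sym (cong (L +_) (+-identityʳ L))) (+-monoˡ-≤ L 1≤L)
  cube : suc L * suc L * suc L ≤ 8 * c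
  cube = ≤-trans (*-mono-≤ (*-mono-≤ 1+L≤2L 1+L≤2L) 1+L≤2L)
                 (≤-reflexive (solve 1 (λ L → con 2 :* L :* (con 2 :* L) :* (con 2 :* L) := con 8 :* (L :* L :* L)) refl L))
  L≤c : L ≤ c
  L≤c = ≤-trans (≤-reflexive (sym (*-identityʳ L)))
                (≤-trans (*-monoʳ-≤ L (*-mono-≤ 1≤L 1≤L)) (≤-reflexive (sym (*-assoc L L L))))
  1≤c : 1 ≤ c
  1≤c = ≤-trans 1≤L L≤c
  linear : 12 * (M + 2 * suc L + 1) ≤ 12 * M * c + 60 * c
  linear = begin
    12 * (M + 2 * suc L + 1)        ≡⟨ solve 2 (λ M L → con 12 :* (M :+ con 2 :* (con 1 :+ L) :+ con 1)
                                                     := con 12 :* M :* con 1 :+ (con 24 :* L :+ con 36 :* con 1)) refl M L ⟩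
    12 * M * 1 + (24 * L + 36 * 1)  ≤⟨ +-mono-≤ (*-monoʳ-≤ (12 * M) 1≤c) (+-mono-≤ (*-monoʳ-≤ 24 L≤c) (*-monoʳ-≤ 36 1≤c)) ⟩
    12 * M * c + (24 * c + 36 * c)  ≡⟨ cong (12 * M * c +_) (sym (*-distribʳ-+ c 24 36)) ⟩
    12 * M * c + 60 * c             ∎

module _ {m n s L : ℕ} where

  private
    M : ℕ
    M = m + 2
    ℓ : ℕ
    ℓ = suc L
    q : ℕ
    q = M + suc ℓ + ℓ + ℓ * s

  small-factors≤2^q : n ≤ 2 ^ ℓ → 3 * m * suc n * n * n ^ s ≤ 2 ^ q
  small-factors≤2^q n≤2^ℓ = begin
    3 * m * suc n * n * n ^ s                      ≤⟨ *-mono-≤ (*-mono-≤ (*-mono-≤ 3m≤2^M 1+n≤2^[1+ℓ]) n≤2^ℓ) n^s≤ ⟩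
    2 ^ M * 2 ^ suc ℓ * 2 ^ ℓ * 2 ^ (ℓ * s)        ≡⟨ cong (λ z → z * 2 ^ ℓ * 2 ^ (ℓ * s)) (sym (^-distribˡ-+-* 2 M (suc ℓ))) ⟩
    2 ^ (M + suc ℓ) * 2 ^ ℓ * 2 ^ (ℓ * s)          ≡⟨ cong (_* 2 ^ (ℓ * s)) (sym (^-distribˡ-+-* 2 (M + suc ℓ) ℓ)) ⟩
    2 ^ (M + suc ℓ + ℓ) * 2 ^ (ℓ * s)              ≡⟨ sym (^-distribˡ-+-* 2 (M + suc ℓ + ℓ) (ℓ * s)) ⟩
    2 ^ q                                          ∎
    where
    open ≤-Reasoning
    3m≤2^M : 3 * m ≤ 2 ^ M
    3m≤2^M = begin
      3 * m          ≤⟨ *-monoˡ-≤ m (m≤m+n 3 1) ⟩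
      4 * m          ≤⟨ *-monoʳ-≤ 4 (<⇒≤ (n<2^n m)) ⟩
      4 * 2 ^ m      ≡⟨ trans (*-comm 4 (2 ^ m)) (sym (^-distribˡ-+-* 2 m 2)) ⟩
      2 ^ M          ∎
    1+n≤2^[1+ℓ] : suc n ≤ 2 ^ suc ℓ
    1+n≤2^[1+ℓ] = ≤-trans (+-mono-≤ (m^n>0 2 ℓ) n≤2^ℓ) (≤-reflexive (cong (2 ^ ℓ +_) (sym (+-identityʳ (2 ^ ℓ)))))
    n^s≤ : n ^ s ≤ 2 ^ (ℓ * s)
    n^s≤ = ≤-trans (^-monoˡ-≤ s n≤2^ℓ) (≤-reflexive (^-*-assoc 2 ℓ s))

  -- s ≤ √(2 n ℓ) and ℓ ≈ log n, so q = O(√n · log^{3/2} n) is far below n.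
  6q≤n : 2400 + 12 * M ≤ L → 2 ^ L < n → s * s ≤ ℓ * (2 * n) → 6 * q ≤ n
  6q≤n M≪L 2^L<n s²≤ = *-cancelˡ-≤ 12 (begin
    12 * (6 * q)   ≡⟨ solve 3 (λ M L s → con 12 :* (con 6 :* (M :+ (con 1 :+ L) :+ L :+ L :* s))
                                 := con 6 :* (con 12 :* (M :+ con 2 :* L :+ con 1)) :+ con 6 :* (con 12 :* L :* s)) refl M ℓ s ⟩
    6 * B + 6 * T  ≤⟨ +-mono-≤ (*-monoʳ-≤ 6 B≤n) (*-monoʳ-≤ 6 T≤n) ⟩
    6 * n + 6 * n  ≡⟨ solve 1 (λ n → con 6 :* n :+ con 6 :* n := con 12 :* n) refl n ⟩
    12 * n         ∎)
    where
    open ≤-Reasoning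
    A : ℕ
    A = 288 * (ℓ * ℓ * ℓ)
    B : ℕ
    B = 12 * (M + 2 * ℓ + 1)
    T : ℕ
    T = 12 * ℓ * s
    A+B≤n : A + B ≤ n
    A+B≤n = ≤-trans (polynomial-bound M L M≪L)
                    (≤-trans (fourthPower≤2^ (≤-trans (m≤m+n 30 (2370 + 12 * M)) M≪L)) (<⇒≤ 2^L<n))
    T≤n : T ≤ n
    T≤n = m*m≤n*n⇒m≤n (begin
      T * T                          ≡⟨ solve 2 (λ L s → con 12 :* L :* s :* (con 12 :* L :* s)
                                                    := con 144 :* (L :* L) :* (s :* s)) refl ℓ s ⟩
      144 * (ℓ * ℓ) * (s * s)        ≤⟨ *-monoʳ-≤ (144 * (ℓ * ℓ)) s²≤ ⟩
      144 * (ℓ * ℓ) * (ℓ * (2 * n))  ≡⟨ solve 2 (λ L n → con 144 :* (L :* L) :* (L :* (con 2 :* n))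
                                                    := con 288 :* (L :* L :* L) :* n) refl ℓ n ⟩
      A * n                          ≤⟨ *-monoˡ-≤ n (≤-trans (m≤m+n A B) A+B≤n) ⟩
      n * n                          ∎)
    B≤n : B ≤ n
    B≤n = ≤-trans (m≤n+m B A) A+B≤n

  small-factors : 2400 + 12 * M ≤ L → 2 ^ L < n → n ≤ 2 ^ ℓ → 2 ^ (s * s) ≤ n ^ (2 * n) →
                  m * n ! * suc n * n ^ suc s * 2 ^ n ≤ n ^ n
  small-factors M≪L 2^L<n n≤2^ℓ 2^s²≤n^2n = *-cancelʳ-≤ _ _ (9 ^ n) {{m^n≢0 9 n}} (begin
    m * n ! * suc n * (n * n ^ s) * 2 ^ n * 9 ^ n
      ≡⟨ solve 7 (λ m f sn n ns t nn → m :* f :* sn :* (n :* ns) :* t :* nn := m :* sn :* n :* ns :* t :* (f :* nn))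
               refl m (n !) (suc n) n (n ^ s) (2 ^ n) (9 ^ n) ⟩
    m * suc n * n * n ^ s * 2 ^ n * (n ! * 9 ^ n)
      ≤⟨ *-monoʳ-≤ (m * suc n * n * n ^ s * 2 ^ n) (n!*9^n≤3*4^n*n^n n) ⟩
    m * suc n * n * n ^ s * 2 ^ n * (3 * 4 ^ n * n ^ n)
      ≡⟨ solve 7 (λ m sn n ns t f nn → m :* sn :* n :* ns :* t :* (con 3 :* f :* nn) := con 3 :* m :* sn :* n :* ns :* (t :* f) :* nn)
               refl m (suc n) n (n ^ s) (2 ^ n) (4 ^ n) (n ^ n) ⟩
    3 * m * suc n * n * n ^ s * (2 ^ n * 4 ^ n) * n ^ n
      ≡⟨ cong (λ z → 3 * m * suc n * n * n ^ s * z * n ^ n) (sym (^-distribʳ-* 2 4 n)) ⟩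
    3 * m * suc n * n * n ^ s * 8 ^ n * n ^ n
      ≤⟨ *-monoˡ-≤ (n ^ n) (*-monoˡ-≤ (8 ^ n) (small-factors≤2^q n≤2^ℓ)) ⟩
    2 ^ q * 8 ^ n * n ^ n
      ≤⟨ *-monoˡ-≤ (n ^ n) (≤-trans (≤-reflexive (*-comm (2 ^ q) (8 ^ n))) (8^n*2^q≤9^n {n} {q} (6q≤n M≪L 2^L<n s²≤))) ⟩
    9 ^ n * n ^ n
      ≡⟨ *-comm (9 ^ n) (n ^ n) ⟩
    n ^ n * 9 ^ n ∎)
    where
    open ≤-Reasoning
    s²≤ : s * s ≤ ℓ * (2 * n)
    s²≤ = 2^-cancel-≤ (≤-trans 2^s²≤n^2n (≤-trans (^-monoˡ-≤ (2 * n) n≤2^ℓ) (≤-reflexive (^-*-assoc 2 ℓ (2 * n)))))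

ceiling-log₂ : ∀ {n} → 2 ≤ n → Σ ℕ λ L → 2 ^ L < n × n ≤ 2 ^ suc L
ceiling-log₂ {n} 2≤n with crossing (λ L → n ≤ 2 ^ L) (λ L → n ≤? 2 ^ L) (<⇒≱ 2≤n) {n} (<⇒≤ (n<2^n n))
... | L , _ , n≰2^L , n≤2^[1+L] = L , ≰⇒> n≰2^L , n≤2^[1+L]

small-factors-beyond : ∀ {m L₀ n s} → 2400 + 12 * (m + 2) ≤ L₀ → 2 ^ suc L₀ ≤ n →
                       2 ^ (s * s) ≤ n ^ (2 * n) → m * n ! * suc n * n ^ suc s * 2 ^ n ≤ n ^ n
small-factors-beyond {m} {L₀} {n} {s} M≪L₀ N≤n with ceiling-log₂ (≤-trans (*-monoʳ-≤ 2 (m^n>0 2 L₀)) N≤n)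
... | L , 2^L<n , n≤2^[1+L] =
  small-factors {m} {n} {s} {L} (≤-trans M≪L₀ (≤-pred (2^-cancel-≤ (≤-trans N≤n n≤2^[1+L])))) 2^L<n n≤2^[1+L]

-- L₀ is written with the variable first so that 2 ^ L₀ stays stuck instead of being unfolded.
eventually-small-factors : ∀ m → Σ ℕ λ N → ∀ {n s} → N ≤ n → 2 ^ (s * s) ≤ n ^ (2 * n) →
                           m * n ! * suc n * n ^ suc s * 2 ^ n ≤ n ^ n
eventually-small-factors m = 2 ^ suc L₀ , λ {n} {s} → small-factors-beyond {m} {L₀} {n} {s} M≪L₀
  where
  L₀ : ℕ
  L₀ = (m + 2) * 12 + 2400
  M≪L₀ : 2400 + 12 * (m + 2) ≤ L₀
  M≪L₀ = ≤-reflexive (trans (+-comm 2400 (12 * (m + 2))) (cong (_+ 2400) (*-comm 12 (m + 2))))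

threshold : ∀ {n} → 30 ≤ n → Σ ℕ λ s → s < n × ¬ n ^ (2 * n) < 2 ^ (s * s) × n ^ (2 * n) < 2 ^ (suc s * suc s)
threshold {n} 30≤n =
  crossing (λ s → n ^ (2 * n) < 2 ^ (s * s)) (λ s → n ^ (2 * n) <? 2 ^ (s * s))
           (λ n^2n<1 → <⇒≱ n^2n<1 (m^n>0 n (2 * n))) n^2n<2^nn
  where
  instance
    n≢0 : NonZero n
    n≢0 = >-nonZero (≤-trans (s≤s z≤n) 30≤n)
  n*n<2^n : n * n < 2 ^ n
  n*n<2^n = begin-strict
    n * n              ≡⟨ sym (*-identityʳ (n * n)) ⟩
    n * n * 1          <⟨ *-monoʳ-< (n * n) {{m*n≢0 n n}} (*-mono-≤ (≤-trans (s≤s (s≤s z≤n)) 30≤n) (≤-trans (s≤s z≤n) 30≤n)) ⟩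
    n * n * (n * n)    ≡⟨ sym (*-assoc (n * n) n n) ⟩
    fourthPower n      ≤⟨ fourthPower≤2^ 30≤n ⟩
    2 ^ n              ∎
    where open ≤-Reasoning
  n^2n<2^nn : n ^ (2 * n) < 2 ^ (n * n)
  n^2n<2^nn = begin-strict
    n ^ (2 * n)        ≡⟨ sym (^-*-assoc n 2 n) ⟩
    (n * (n * 1)) ^ n  ≡⟨ cong (λ x → (n * x) ^ n) (*-identityʳ n) ⟩
    (n * n) ^ n        <⟨ ^-monoˡ-< n n*n<2^n ⟩
    (2 ^ n) ^ n        ≡⟨ ^-*-assoc 2 n n ⟩
    2 ^ (n * n)        ∎
    where open ≤-Reasoning

n≤2^t : ∀ {n t} → 1 ≤ n → t ≤ 2 * n → n ^ (2 * n) < 2 ^ (t * t) → n ≤ 2 ^ t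
n≤2^t {n} {t} 1≤n t≤2n n^2n<2^tt = ≮⇒≥ λ 2^t<n → <⇒≱ n^2n<2^tt (begin
  2 ^ (t * t)    ≡⟨ sym (^-*-assoc 2 t t) ⟩
  (2 ^ t) ^ t    ≤⟨ ^-monoˡ-≤ t (<⇒≤ 2^t<n) ⟩
  n ^ t          ≤⟨ ^-monoʳ-≤ n {{>-nonZero 1≤n}} t≤2n ⟩
  n ^ (2 * n)    ∎)
  where open ≤-Reasoning

¬AboveBound⇒≤ : ∀ {n s k} → ¬ n ^ (2 * n) < 2 ^ (s * s) → ¬ AboveBound n k → k ≤ n ∸ suc s
¬AboveBound⇒≤ {n} {s} {k} not-yet below = m+n≤o⇒m≤o∸n k (begin
  k + suc s         ≤⟨ +-monoʳ-≤ k s<n∸k ⟩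
  k + (n ∸ k)       ≡⟨ m+[n∸m]≡n (<⇒≤ k<n) ⟩
  n                 ∎)
  where
  open ≤-Reasoning
  s<n∸k : s < n ∸ k
  s<n∸k = ≰⇒> λ n∸k≤s → below (≤-trans (^-monoʳ-≤ 2 (*-mono-≤ n∸k≤s n∸k≤s)) (≮⇒≥ not-yet))
  k<n : k < n
  k<n = m∸n≢0⇒n<m (λ n∸k≡0 → n≮0 (subst (s <_) n∸k≡0 s<n∸k))

InvSatisfies-AboveBound : ∀ {n K} {D : Digraph n} → (∀ k → ¬ AboveBound n k → k ≤ K) →
                          InvSatisfies D (K <_) → InvSatisfies D (AboveBound n)
InvSatisfies-AboveBound {n} below⇒≤ K<inv k Xs decycling with 2 ^ ((n ∸ k) * (n ∸ k)) ≤? n ^ (2 * n)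
... | yes above = above
... | no  below = ⊥-elim (<⇒≱ (K<inv k Xs decycling) (below⇒≤ k below))

most-tournaments : ∀ m → Σ ℕ λ N → ∀ n → N ≤ n →
  Σ (List (Tournament n)) λ good →
    AllPairs Differ good
    × All (λ T → InvSatisfies (proj₁ T) (AboveBound n)) good
    × m * (numTournaments n ∸ length good) ≤ numTournaments n
most-tournaments m = proj₁ (eventually-small-factors m) + 30 , λ n N≤n →
  let 30≤n = ≤-trans (m≤n+m 30 _) N≤n
      s , s<n , not-yet , n^2n<2^tt = threshold 30≤n
      K = n ∸ suc s
      good , differ , inv>K , covered = tournamentsWithInv> n K
  in good , differ , All.map (InvSatisfies-AboveBound (λ k → ¬AboveBound⇒≤ not-yet)) inv>K ,
     (begin
       m * (numTournaments n ∸ length good)     ≤⟨ *-monoʳ-≤ m (m≤n+o⇒m∸n≤o _ (length good) covered) ⟩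
       m * (n ! * numGramCodesUpTo n K)         ≤⟨ few-candidates {m} {n} {K} {suc s} (m∸n+n≡m s<n) n^2n<2^tt
                                                     (n≤2^t (≤-trans (s≤s z≤n) 30≤n) (≤-trans s<n (m≤m+n n (n + 0))) n^2n<2^tt)
                                                     (proj₂ (eventually-small-factors m) {n} {s} (≤-trans (m≤m+n _ 30) N≤n) (≮⇒≥ not-yet)) ⟩
       numTournaments n                          ∎)
  where open ≤-Reasoning

nonempty : ∀ {n} {P : Tournament n → Set} {good : List (Tournament n)} → All P good →
           2 * (numTournaments n ∸ length good) ≤ numTournaments n → Σ (Tournament n) P
nonempty     (pT ∷ _) _     = _ , pT
nonempty {n} []       2N≤N  = ⊥-elim (<⇒≱ N<2N 2N≤N)
  where
  open ≤-Reasoning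
  N : ℕ
  N = numTournaments n
  N<2N : N < 2 * N
  N<2N = begin-strict
    N          <⟨ m<m+n N (m^n>0 2 (n C 2)) ⟩
    N + N      ≡⟨ cong (N +_) (sym (+-identityʳ N)) ⟩
    2 * N      ∎

theorem1p9 :
    (Σ ℕ λ N → ∀ n → N ≤ n →
      Σ (Tournament n) λ T → InvSatisfies (proj₁ T) (AboveBound n))
    ×
    (∀ m → 1 ≤ m → Σ ℕ λ N → ∀ n → N ≤ n →
      Σ (List (Tournament n)) λ good →
        AllPairs Differ good
        × All (λ T → InvSatisfies (proj₁ T) (AboveBound n)) good
        × m * (numTournaments n ∸ length good) ≤ numTournaments n)
theorem1p9 =
  (proj₁ (most-tournaments 2) ,
   λ n N≤n → let _ , _ , inv , count = proj₂ (most-tournaments 2) n N≤n in nonempty inv count) ,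
  λ m _ → most-tournaments m
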